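{- Let $0\le a,b,c,h\le n$ with $a+b+c=n$, and $0\le s\le\min(h,b)$. (1) If $c\le n-h$ and $(a,b,c)\ne(0,h,n-h)$, then $$\sum_{i=s}^{\min(s+c,h)}M_{n,h}(a,b,c,i,s)=(-1)^{n+c+s+1}(-q)^{\frac{c}{2}+\frac{c^2}{2}-h^2-\frac n2-cn+hn+\frac{n^2}{2}-ch+\frac s2-\frac{s^2}{2}}\cdot\frac{P(b)P(n-c-s)P(n-c-s-1)}{P(b-s)P(s)P(n-h-c)P(h-s)}.$$ (2) If $c>n-h$ and $a\ne0$, then $\sum_{i=s}^{\min(s+c,h)}M_{n,h}(a,b,c,i,s)=0$.
   Context: $q$ is a power of an odd prime. For an integer $k$ put $P(k)=\prod_{l=1}^{k}(1-(-q)^{ -l})$ (empty products equal $1$, empty sums $0$). For nonnegative integers $a,b,c$ and an integer $j$: if $a+b>0$, $\mathcal C_j(a,b,c)=(-1)^{j+1}\prod_{i=1}^{a+b-1}(1-(-q)^i)$; and $\mathcal C_j(0,0,c)=\sum_{l=1}^{c}\frac{1}{(-q)^l-1}$. For integers $n,h,a,b,c,i,s$, $$M_{n,h}(a,b,c,i,s)=(-q)^{n(h-i)+\frac{(i-s)(2n-i+s+1)}{2}-h^2+s(2n-2c-s)}(-1)^{i+h}\frac{P(n-i)}{P(n-h)P(h)}\cdot\frac{\prod_{l=s+1}^{h}(1-(-q)^{ -l})}{P(h-i)P(i-s)}\cdot\frac{P(c)P(b)}{P(c-i+s)P(b-s)}\cdot\mathcal C_{h+1-s}(a,b-s,c+s-i).$$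 -}

module Defs where

open import Data.Nat as ℕ using (ℕ; zero; suc; _∸_; _⊔_; _⊓_)
open import Data.Nat.Primality using (Prime)
open import Data.Integer as ℤ using (ℤ; +_; -[1+_]; ∣_∣)
open import Data.Rational as ℚ using (ℚ; 0ℚ; 1ℚ; _+_; _*_; _-_; -_; ≢-nonZero)
open import Data.Rational.Properties using (_≟_)
open import Data.Product using (Σ; ∃; _×_)
open import Relation.Binary.PropositionalEquality using (_≡_; _≢_)
open import Relation.Nullary using (yes; no)

IsOddPrimePower : ℕ → Set
IsOddPrimePower q = Σ ℕ λ p → Σ ℕ λ k → Prime p × (p ≢ 2) × (k ≢ 0) × (q ≡ p ℕ.^ k)

_^ℚ_ : ℚ → ℕ → ℚ
x ^ℚ zero = 1ℚ
x ^ℚ suc k = x * (x ^ℚ k)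

-- total division (denominator 0 gives 0); only applied to nonzero denominators here
_/ₜ_ : ℚ → ℚ → ℚ
x /ₜ y with y ≟ 0ℚ
... | yes _ = 0ℚ
... | no y≢0 = ℚ._÷_ x y {{≢-nonZero y≢0}}

negq : ℕ → ℚ
negq q = - (ℚ._/_ (+ q) 1)

pw : ℕ → ℤ → ℚ
pw q (+ k) = negq q ^ℚ k
pw q -[1+ k ] = 1ℚ /ₜ (negq q ^ℚ suc k)

sgn : ℤ → ℚ
sgn k = (- 1ℚ) ^ℚ ∣ k ∣

prodTo : ℕ → (ℕ → ℚ) → ℚ
prodTo zero f = 1ℚ
prodTo (suc k) f = prodTo k f * f (suc k)

sumTo : ℕ → (ℕ → ℚ) → ℚ
sumTo zero f = 0ℚ
sumTo (suc k) f = sumTo k f + f (suc k)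

P : ℕ → ℤ → ℚ
P q (+ k) = prodTo k (λ l → 1ℚ - pw q (ℤ.- (+ l)))
P q -[1+ k ] = 1ℚ

Pfrom : ℕ → ℕ → ℕ → ℚ
Pfrom q s h = prodTo (h ∸ s) (λ t → 1ℚ - pw q (ℤ.- (+ (s ℕ.+ t))))

Cc : ℕ → ℤ → ℕ → ℕ → ℕ → ℚ
Cc q j a b c with a ℕ.+ b
... | zero = sumTo c (λ l → 1ℚ /ₜ (pw q (+ l) - 1ℚ))
... | suc m = sgn (j ℤ.+ ℤ.1ℤ) * prodTo m (λ i → 1ℚ - pw q (+ i))

-- M_{n,h}(a,b,c,i,s); used only for s ≤ i ≤ min(s+c,h), s ≤ b, where the
-- natural-number subtractions b ∸ s and (c + s) ∸ i are the true differences.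
M : ℕ → (n h a b c i s : ℕ) → ℚ
M q n h a b c i s =
  pw q (N ℤ.* (H ℤ.- I)
        ℤ.+ ((I ℤ.- S) ℤ.* (+ 2 ℤ.* N ℤ.- I ℤ.+ S ℤ.+ ℤ.1ℤ)) ℤ./ (+ 2)
        ℤ.- H ℤ.* H
        ℤ.+ S ℤ.* (+ 2 ℤ.* N ℤ.- + 2 ℤ.* C ℤ.- S))
  * sgn (I ℤ.+ H)
  * (P q (N ℤ.- I) /ₜ (P q (N ℤ.- H) * P q H))
  * (Pfrom q s h /ₜ (P q (H ℤ.- I) * P q (I ℤ.- S)))
  * ((P q C * P q B) /ₜ (P q (C ℤ.- I ℤ.+ S) * P q (B ℤ.- S)))
  * Cc q (H ℤ.+ ℤ.1ℤ ℤ.- S) a (b ∸ s) ((c ℕ.+ s) ∸ i)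
  where
  N = + n ; H = + h ; I = + i ; S = + s ; C = + c ; B = + b

sumFromTo : ℕ → ℕ → (ℕ → ℚ) → ℚ
sumFromTo lo hi f = go (suc hi ∸ lo)
  where
  go : ℕ → ℚ
  go zero = 0ℚ
  go (suc k) = go k + f (lo ℕ.+ k)

LHS : ℕ → (n h a b c s : ℕ) → ℚ
LHS q n h a b c s = sumFromTo s ((s ℕ.+ c) ⊓ h) (λ i → M q n h a b c i s)

RHS1 : ℕ → (n h b c s : ℕ) → ℚ
RHS1 q n h b c s =
  sgn (N ℤ.+ C ℤ.+ S ℤ.+ ℤ.1ℤ)
  * pw q ((C ℤ.+ C ℤ.* C ℤ.- N ℤ.+ N ℤ.* N ℤ.+ S ℤ.- S ℤ.* S) ℤ./ (+ 2)
          ℤ.- H ℤ.* H ℤ.- C ℤ.* N ℤ.+ H ℤ.* N ℤ.- C ℤ.* H)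
  * ((P q B * P q (N ℤ.- C ℤ.- S) * P q (N ℤ.- C ℤ.- S ℤ.- ℤ.1ℤ))
     /ₜ (P q (B ℤ.- S) * P q S * P q (N ℤ.- H ℤ.- C) * P q (H ℤ.- S)))
  where
  N = + n ; H = + h ; S = + s ; C = + c ; B = + b

{-# OPTIONS --safe #-}
-- Put t = (-q)⁻¹, H = h - s, D = n - h and i = s + j, so that P(k) = (t;t)_k.  As long as
-- a + b - s > 0 (which, when c ≤ n - h, fails exactly in the excluded case), 𝒞 is the
-- product ±∏(1 - (-q)^l) = ±(-q)^{…}(t;t)_{a+b-s-1} and does not depend on i.  Then P(c)·M
-- at i = s + j is a j-independent factor times [c,j]_t (-1)^j t^{j(j-1)/2} (t^{H-j+1};t)_D,
-- and these terms vanish for H < j ≤ c, so P(c) times the sum is the c-th q-difference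
--   Δ(D,c) = Σ_{j≤c} [c,j]_t (-1)^j t^{j(j-1)/2} (t^{H-j+1};t)_D.
-- Pascal's rule for the Gaussian binomials gives Δ(D+1,c+1) = t^H (1 - t^{D+1}) Δ(D,c), so
-- Δ(D,c) = 0 for D < c, which is part (2), and otherwise
-- Δ(D,c) = t^{cH} (t;t)_D (t^{H+1};t)_{D-c} / (t;t)_{D-c}; part (1) is then the bookkeeping
-- of signs and powers of -q.
module Submission where

open import Defs
open import Data.Nat using (ℕ; _+_; _∸_; _≤_; _>_; _⊓_)
open import Data.Product using (_×_)
open import Relation.Binary.PropositionalEquality using (_≡_; _≢_)
open import Relation.Nullary using (¬_)
open import Data.Rational using (0ℚ)

open import Data.Nat as ℕ using (zero; suc; _<_; s≤s)
import Data.Nat.Properties as ℕₚ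
open import Data.Nat.Primality using (prime⇒nonTrivial)
open import Data.Integer as ℤ using (ℤ; +_; -[1+_]; 1ℤ)
import Data.Integer.Properties as ℤₚ
open import Data.Integer.DivMod using (a≡a%ℕn+[a/ℕn]*n; n%ℕd<d; div-pos-is-/ℕ)
open import Data.Integer.Tactic.RingSolver using (solve-∀)
open import Data.Rational as ℚ using (ℚ; 1ℚ; _*_) renaming (_+_ to _+ℚ_; _-_ to _-ℚ_)
import Data.Rational.Properties as ℚₚ
open import Data.Rational.Solver using (module +-*-Solver)
open +-*-Solver using (solve; _:+_; _:*_; _:-_; con; _:=_)
import Data.Rational.Unnormalised as ℚᵘ
import Data.Rational.Unnormalised.Properties as ℚᵘₚ
open import Data.Product using (_,_)
open import Data.Sum using (inj₁; inj₂)
open import Data.Empty using (⊥-elim)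
open import Relation.Binary.PropositionalEquality
  using (refl; sym; trans; cong; cong₂; subst; subst₂; module ≡-Reasoning)
open import Relation.Nullary using (yes; no)
open import Algebra.Bundles using (CommutativeMonoid)
import Algebra.Solver.CommutativeMonoid ℚₚ.*-1-commutativeMonoid as ×-Solver
open ×-Solver using (_⊜_)
open import Algebra.Properties.Group ℚₚ.+-0-group using (x∙y⁻¹≈ε⇒x≈y)
open import Algebra.Properties.CommutativeSemigroup
  (CommutativeMonoid.commutativeSemigroup ℚₚ.*-1-commutativeMonoid)
  using () renaming (interchange to *-interchange; x∙yz≈y∙xz to *-x∙yz≈y∙xz)
open import Algebra.Properties.CommutativeSemigroup
  (CommutativeMonoid.commutativeSemigroup ℚₚ.+-0-commutativeMonoid)
  using () renaming (interchange to +-interchange; x∙yz≈y∙xz to +-x∙yz≈y∙xz)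

open ≡-Reasoning

infixl 7 _⊗_

_⊗_ : ∀ {k} → ×-Solver.Expr k → ×-Solver.Expr k → ×-Solver.Expr k
_⊗_ = ×-Solver._⊕_

-- opaque: unfolding the zero test inside _/ₜ_ derails unification in later proofs
opaque
  inv : ℚ → ℚ
  inv y = 1ℚ /ₜ y

  /ₜ≡*inv : ∀ u y → u /ₜ y ≡ u * inv y
  /ₜ≡*inv u y with y ℚₚ.≟ 0ℚ
  ... | yes _ = sym (ℚₚ.*-zeroʳ u)
  ... | no _  = cong (u *_) (sym (ℚₚ.*-identityˡ _))

  *-invʳ : ∀ {y} → y ≢ 0ℚ → y * inv y ≡ 1ℚ
  *-invʳ {y} y≢0 with y ℚₚ.≟ 0ℚ
  ... | yes y≡0 = ⊥-elim (y≢0 y≡0)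
  ... | no y≢0′ = trans (cong (y *_) (ℚₚ.*-identityˡ _)) (ℚₚ.*-inverseʳ y {{ℚ.≢-nonZero y≢0′}})

*-invˡ : ∀ {y} → y ≢ 0ℚ → inv y * y ≡ 1ℚ
*-invˡ {y} y≢0 = trans (ℚₚ.*-comm (inv y) y) (*-invʳ y≢0)

*-cancelˡ-≡ : ∀ {a u v} → a ≢ 0ℚ → a * u ≡ a * v → u ≡ v
*-cancelˡ-≡ {a} {u} {v} a≢0 au≡av = begin
  u                ≡⟨ sym (ℚₚ.*-identityˡ u) ⟩
  1ℚ * u           ≡⟨ cong (_* u) (sym (*-invˡ a≢0)) ⟩
  inv a * a * u    ≡⟨ ℚₚ.*-assoc (inv a) a u ⟩
  inv a * (a * u)  ≡⟨ cong (inv a *_) au≡av ⟩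
  inv a * (a * v)  ≡⟨ sym (ℚₚ.*-assoc (inv a) a v) ⟩
  inv a * a * v    ≡⟨ cong (_* v) (*-invˡ a≢0) ⟩
  1ℚ * v           ≡⟨ ℚₚ.*-identityˡ v ⟩
  v                ∎

*-≢0 : ∀ {a b} → a ≢ 0ℚ → b ≢ 0ℚ → a * b ≢ 0ℚ
*-≢0 {a} {b} a≢0 b≢0 ab≡0 = b≢0 (*-cancelˡ-≡ a≢0 (trans ab≡0 (sym (ℚₚ.*-zeroʳ a))))

inv-unique : ∀ {y w} → y * w ≡ 1ℚ → inv y ≡ w
inv-unique {y} {w} yw≡1 = *-cancelˡ-≡ y≢0 (trans (*-invʳ y≢0) (sym yw≡1))
  where
  y≢0 : y ≢ 0ℚ
  y≢0 y≡0 = ℚₚ.1≢0 (trans (sym yw≡1) (trans (cong (_* w) y≡0) (ℚₚ.*-zeroˡ w)))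

inv-distrib-* : ∀ {a b} → a ≢ 0ℚ → b ≢ 0ℚ → inv (a * b) ≡ inv a * inv b
inv-distrib-* {a} {b} a≢0 b≢0 = inv-unique (begin
  a * b * (inv a * inv b)      ≡⟨ *-interchange a b (inv a) (inv b) ⟩
  a * inv a * (b * inv b)      ≡⟨ cong₂ _*_ (*-invʳ a≢0) (*-invʳ b≢0) ⟩
  1ℚ                           ∎)

*≡⇒≡*inv : ∀ {a u v} → a ≢ 0ℚ → a * u ≡ v → u ≡ v * inv a
*≡⇒≡*inv {a} {u} {v} a≢0 au≡v = begin
  u                ≡⟨ sym (ℚₚ.*-identityˡ u) ⟩
  1ℚ * u           ≡⟨ cong (_* u) (sym (*-invˡ a≢0)) ⟩
  inv a * a * u    ≡⟨ ℚₚ.*-assoc (inv a) a u ⟩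
  inv a * (a * u)  ≡⟨ cong (inv a *_) au≡v ⟩
  inv a * v        ≡⟨ ℚₚ.*-comm (inv a) v ⟩
  v * inv a        ∎

*-inv-cancel³ : ∀ X {a b c} → a ≢ 0ℚ → b ≢ 0ℚ → c ≢ 0ℚ → X * (a * inv a) * (b * inv b) * (c * inv c) ≡ X
*-inv-cancel³ X {a} {b} {c} a≢0 b≢0 c≢0 = begin
  X * (a * inv a) * (b * inv b) * (c * inv c)   ≡⟨ cong₂ (λ u v → X * u * v * (c * inv c)) (*-invʳ a≢0) (*-invʳ b≢0) ⟩
  X * 1ℚ * 1ℚ * (c * inv c)                     ≡⟨ cong (X * 1ℚ * 1ℚ *_) (*-invʳ c≢0) ⟩
  X * 1ℚ * 1ℚ * 1ℚ                              ≡⟨ cong (λ u → u * 1ℚ * 1ℚ) (ℚₚ.*-identityʳ X) ⟩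
  X * 1ℚ * 1ℚ                                   ≡⟨ cong (_* 1ℚ) (ℚₚ.*-identityʳ X) ⟩
  X * 1ℚ                                        ≡⟨ ℚₚ.*-identityʳ X ⟩
  X                                             ∎

infixr 8 _^ᶻ_

_^ᶻ_ : ℚ → ℤ → ℚ
y ^ᶻ + k      = y ^ℚ k
y ^ᶻ -[1+ k ] = 1ℚ /ₜ (y ^ℚ suc k)

^ᶻ-negsuc : ∀ y k → y ^ᶻ -[1+ k ] ≡ inv (y ^ℚ suc k)
^ᶻ-negsuc y k = trans (/ₜ≡*inv 1ℚ _) (ℚₚ.*-identityˡ _)

^ℚ-≢0 : ∀ {y} → y ≢ 0ℚ → ∀ k → y ^ℚ k ≢ 0ℚ
^ℚ-≢0 y≢0 zero    = ℚₚ.1≢0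
^ℚ-≢0 y≢0 (suc k) = *-≢0 y≢0 (^ℚ-≢0 y≢0 k)

module _ {y : ℚ} (y≢0 : y ≢ 0ℚ) where

  ^ᶻ-suc : ∀ z → y ^ᶻ (z ℤ.+ 1ℤ) ≡ y * y ^ᶻ z
  ^ᶻ-suc (+ k)             = cong (y ^ℚ_) (ℕₚ.+-comm k 1)
  ^ᶻ-suc -[1+ zero ]       = sym (begin
    y * y ^ᶻ -[1+ 0 ]        ≡⟨ cong (y *_) (^ᶻ-negsuc y 0) ⟩
    y * inv (y * 1ℚ)         ≡⟨ cong (λ u → y * inv u) (ℚₚ.*-identityʳ y) ⟩
    y * inv y                ≡⟨ *-invʳ y≢0 ⟩
    1ℚ                       ∎)
  ^ᶻ-suc -[1+ suc k ]      = begin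
    y ^ᶻ -[1+ k ]                        ≡⟨ ^ᶻ-negsuc y k ⟩
    inv (y ^ℚ suc k)                     ≡⟨ sym (ℚₚ.*-identityˡ _) ⟩
    1ℚ * inv (y ^ℚ suc k)                ≡⟨ cong (_* inv (y ^ℚ suc k)) (sym (*-invʳ y≢0)) ⟩
    y * inv y * inv (y ^ℚ suc k)         ≡⟨ ℚₚ.*-assoc y _ _ ⟩
    y * (inv y * inv (y ^ℚ suc k))       ≡⟨ cong (y *_) (sym (inv-distrib-* y≢0 (^ℚ-≢0 y≢0 (suc k)))) ⟩
    y * inv (y ^ℚ suc (suc k))           ≡⟨ cong (y *_) (sym (^ᶻ-negsuc y (suc k))) ⟩
    y * y ^ᶻ -[1+ suc k ]                ∎

  ^ᶻ-pred : ∀ z → y ^ᶻ (z ℤ.- 1ℤ) ≡ inv y * y ^ᶻ z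
  ^ᶻ-pred z = *-cancelˡ-≡ y≢0 (begin
    y * y ^ᶻ (z ℤ.- 1ℤ)          ≡⟨ sym (^ᶻ-suc (z ℤ.- 1ℤ)) ⟩
    y ^ᶻ (z ℤ.- 1ℤ ℤ.+ 1ℤ)       ≡⟨ cong (y ^ᶻ_) (cancel z) ⟩
    y ^ᶻ z                       ≡⟨ sym (ℚₚ.*-identityˡ _) ⟩
    1ℚ * y ^ᶻ z                  ≡⟨ cong (_* y ^ᶻ z) (sym (*-invʳ y≢0)) ⟩
    y * inv y * y ^ᶻ z           ≡⟨ ℚₚ.*-assoc y (inv y) _ ⟩
    y * (inv y * y ^ᶻ z)         ∎)
    where
    cancel : ∀ z → z ℤ.- 1ℤ ℤ.+ 1ℤ ≡ z
    cancel = solve-∀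

  ^ᶻ-+ : ∀ a b → y ^ᶻ (a ℤ.+ b) ≡ y ^ᶻ a * y ^ᶻ b
  ^ᶻ-+ a (+ zero)          = trans (cong (y ^ᶻ_) (ℤₚ.+-identityʳ a)) (sym (ℚₚ.*-identityʳ _))
  ^ᶻ-+ a (+ suc k)         = begin
    y ^ᶻ (a ℤ.+ + suc k)           ≡⟨ cong (y ^ᶻ_) (shift a (+ k)) ⟩
    y ^ᶻ (a ℤ.+ + k ℤ.+ 1ℤ)        ≡⟨ ^ᶻ-suc (a ℤ.+ + k) ⟩
    y * y ^ᶻ (a ℤ.+ + k)           ≡⟨ cong (y *_) (^ᶻ-+ a (+ k)) ⟩
    y * (y ^ᶻ a * y ^ℚ k)          ≡⟨ *-x∙yz≈y∙xz y (y ^ᶻ a) (y ^ℚ k) ⟩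
    y ^ᶻ a * (y * y ^ℚ k)          ∎
    where
    shift : ∀ a k → a ℤ.+ (1ℤ ℤ.+ k) ≡ a ℤ.+ k ℤ.+ 1ℤ
    shift = solve-∀
  ^ᶻ-+ a -[1+ zero ]       = begin
    y ^ᶻ (a ℤ.- 1ℤ)                ≡⟨ ^ᶻ-pred a ⟩
    inv y * y ^ᶻ a                 ≡⟨ ℚₚ.*-comm (inv y) _ ⟩
    y ^ᶻ a * inv y                 ≡⟨ cong (y ^ᶻ a *_) (sym (trans (^ᶻ-pred (+ 0)) (ℚₚ.*-identityʳ (inv y)))) ⟩
    y ^ᶻ a * y ^ᶻ -[1+ 0 ]         ∎
  ^ᶻ-+ a -[1+ suc k ]      = begin
    y ^ᶻ (a ℤ.+ -[1+ suc k ])              ≡⟨ cong (y ^ᶻ_) (shift a) ⟩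
    y ^ᶻ (a ℤ.+ -[1+ k ] ℤ.- 1ℤ)           ≡⟨ ^ᶻ-pred (a ℤ.+ -[1+ k ]) ⟩
    inv y * y ^ᶻ (a ℤ.+ -[1+ k ])          ≡⟨ cong (inv y *_) (^ᶻ-+ a -[1+ k ]) ⟩
    inv y * (y ^ᶻ a * y ^ᶻ -[1+ k ])       ≡⟨ *-x∙yz≈y∙xz (inv y) (y ^ᶻ a) _ ⟩
    y ^ᶻ a * (inv y * y ^ᶻ -[1+ k ])       ≡⟨ cong (y ^ᶻ a *_) (sym (^ᶻ-pred -[1+ k ])) ⟩
    y ^ᶻ a * y ^ᶻ (-[1+ k ] ℤ.- 1ℤ)        ≡⟨ cong (λ b → y ^ᶻ a * y ^ᶻ b) (sym -[1+suc]≡) ⟩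
    y ^ᶻ a * y ^ᶻ -[1+ suc k ]             ∎
    where
    -[1+suc]≡ : -[1+ suc k ] ≡ -[1+ k ] ℤ.- 1ℤ
    -[1+suc]≡ = cong (λ u → -[1+ suc u ]) (sym (ℕₚ.+-identityʳ k))
    shift : ∀ a → a ℤ.+ -[1+ suc k ] ≡ a ℤ.+ -[1+ k ] ℤ.- 1ℤ
    shift a = trans (cong (λ b → a ℤ.+ b) -[1+suc]≡) (sym (ℤₚ.+-assoc a -[1+ k ] (ℤ.- 1ℤ)))

-1ℚ : ℚ
-1ℚ = ℚ.- 1ℚ

-1^k*-1^k≡1 : ∀ k → -1ℚ ^ℚ k * -1ℚ ^ℚ k ≡ 1ℚ
-1^k*-1^k≡1 zero    = refl
-1^k*-1^k≡1 (suc k) = trans (*-interchange -1ℚ (-1ℚ ^ℚ k) -1ℚ (-1ℚ ^ℚ k)) (cong (1ℚ *_) (-1^k*-1^k≡1 k))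

sgn≡-1^ᶻ : ∀ z → sgn z ≡ -1ℚ ^ᶻ z
sgn≡-1^ᶻ (+ k)      = refl
sgn≡-1^ᶻ -[1+ k ]   = sym (trans (^ᶻ-negsuc -1ℚ k) (inv-unique (-1^k*-1^k≡1 (suc k))))

sgn-+ : ∀ a b → sgn (a ℤ.+ b) ≡ sgn a * sgn b
sgn-+ a b = begin
  sgn (a ℤ.+ b)             ≡⟨ sgn≡-1^ᶻ (a ℤ.+ b) ⟩
  -1ℚ ^ᶻ (a ℤ.+ b)          ≡⟨ ^ᶻ-+ (λ ()) a b ⟩
  -1ℚ ^ᶻ a * -1ℚ ^ᶻ b       ≡⟨ sym (cong₂ _*_ (sgn≡-1^ᶻ a) (sgn≡-1^ᶻ b)) ⟩
  sgn a * sgn b             ∎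

sgn-double : ∀ z → sgn (z ℤ.+ z) ≡ 1ℚ
sgn-double z = trans (sgn-+ z z) (-1^k*-1^k≡1 ℤ.∣ z ∣)

∑< : ℕ → (ℕ → ℚ) → ℚ
∑< zero    f = 0ℚ
∑< (suc k) f = ∑< k f +ℚ f k

∑<-cong : ∀ k {f g} → (∀ j → j < k → f j ≡ g j) → ∑< k f ≡ ∑< k g
∑<-cong zero    f≗g = refl
∑<-cong (suc k) f≗g = cong₂ _+ℚ_ (∑<-cong k (λ j j<k → f≗g j (ℕₚ.m<n⇒m<1+n j<k))) (f≗g k ℕₚ.≤-refl)

∑<-suc : ∀ k f → ∑< (suc k) f ≡ f 0 +ℚ ∑< k (λ j → f (suc j))
∑<-suc zero    f = trans (ℚₚ.+-identityˡ (f 0)) (sym (ℚₚ.+-identityʳ (f 0)))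
∑<-suc (suc k) f = trans (cong (_+ℚ f (suc k)) (∑<-suc k f)) (ℚₚ.+-assoc (f 0) _ _)

∑<-+ : ∀ k f g → ∑< k (λ j → f j +ℚ g j) ≡ ∑< k f +ℚ ∑< k g
∑<-+ zero    f g = refl
∑<-+ (suc k) f g = trans (cong (_+ℚ (f k +ℚ g k)) (∑<-+ k f g)) (+-interchange (∑< k f) (∑< k g) (f k) (g k))

*-distribˡ-∑< : ∀ k a f → a * ∑< k f ≡ ∑< k (λ j → a * f j)
*-distribˡ-∑< zero    a f = ℚₚ.*-zeroʳ a
*-distribˡ-∑< (suc k) a f = trans (ℚₚ.*-distribˡ-+ a (∑< k f) (f k)) (cong (_+ℚ a * f k) (*-distribˡ-∑< k a f))

∑<-0 : ∀ k f → (∀ j → j < k → f j ≡ 0ℚ) → ∑< k f ≡ 0ℚ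
∑<-0 zero    f f≡0 = refl
∑<-0 (suc k) f f≡0 = cong₂ _+ℚ_ (∑<-0 k f (λ j j<k → f≡0 j (ℕₚ.m<n⇒m<1+n j<k))) (f≡0 k ℕₚ.≤-refl)

∑<-+-zeros : ∀ k r f → (∀ j → k ≤ j → j < k + r → f j ≡ 0ℚ) → ∑< (k + r) f ≡ ∑< k f
∑<-+-zeros k zero    f f≡0 = cong (λ l → ∑< l f) (ℕₚ.+-identityʳ k)
∑<-+-zeros k (suc r) f f≡0 = begin
  ∑< (k + suc r) f             ≡⟨ cong (λ l → ∑< l f) (ℕₚ.+-suc k r) ⟩
  ∑< (k + r) f +ℚ f (k + r)    ≡⟨ cong₂ _+ℚ_ (∑<-+-zeros k r f (λ j k≤j j<k+r → f≡0 j k≤j (ℕₚ.<-trans j<k+r k+r<k+1+r)))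
                                              (f≡0 (k + r) (ℕₚ.m≤m+n k r) k+r<k+1+r) ⟩
  ∑< k f +ℚ 0ℚ                 ≡⟨ ℚₚ.+-identityʳ (∑< k f) ⟩
  ∑< k f                       ∎
  where
  k+r<k+1+r : k + r < k + suc r
  k+r<k+1+r = ℕₚ.+-monoʳ-< k ℕₚ.≤-refl

sumFromTo≡∑< : ∀ lo hi f → sumFromTo lo hi f ≡ ∑< (suc hi ∸ lo) (λ j → f (lo + j))
sumFromTo≡∑< lo hi f = goal
  where
  -- the local loop of sumFromTo; the with below abstracts its argument so that unification finds it
  go : ℕ → ℚ
  go = _
  go≡∑< : ∀ k → go k ≡ ∑< k (λ j → f (lo + j))
  go≡∑< zero    = refl
  go≡∑< (suc k) = cong (_+ℚ f (lo + k)) (go≡∑< k)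
  goal : sumFromTo lo hi f ≡ ∑< (suc hi ∸ lo) (λ j → f (lo + j))
  goal with suc hi ∸ lo
  ... | k = go≡∑< k

prodTo-suc : ∀ k f → prodTo (suc k) f ≡ f 1 * prodTo k (λ j → f (suc j))
prodTo-suc zero    f = trans (ℚₚ.*-identityˡ (f 1)) (sym (ℚₚ.*-identityʳ (f 1)))
prodTo-suc (suc k) f = trans (cong (_* f (suc (suc k))) (prodTo-suc k f)) (ℚₚ.*-assoc (f 1) _ _)

prodTo-cong : ∀ k {f g} → (∀ j → f j ≡ g j) → prodTo k f ≡ prodTo k g
prodTo-cong zero    f≗g = refl
prodTo-cong (suc k) f≗g = cong₂ _*_ (prodTo-cong k f≗g) (f≗g (suc k))

prodTo-≡0 : ∀ k f {j} → 1 ≤ j → j ≤ k → f j ≡ 0ℚ → prodTo k f ≡ 0ℚ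
prodTo-≡0 zero    f 1≤j j≤0 fj≡0 = ⊥-elim (ℕₚ.<⇒≱ 1≤j j≤0)
prodTo-≡0 (suc k) f 1≤j j≤1+k fj≡0 with ℕₚ.m≤n⇒m<n∨m≡n j≤1+k
... | inj₁ j<1+k = trans (cong (_* f (suc k)) (prodTo-≡0 k f 1≤j (ℕₚ.≤-pred j<1+k) fj≡0)) (ℚₚ.*-zeroˡ (f (suc k)))
... | inj₂ refl  = trans (cong (prodTo k f *_) fj≡0) (ℚₚ.*-zeroʳ (prodTo k f))

+m-+n≡+[m∸n] : ∀ {m n} → n ≤ m → + m ℤ.- + n ≡ + (m ∸ n)
+m-+n≡+[m∸n] {m} {n} n≤m = trans (ℤₚ.m-n≡m⊖n m n) (ℤₚ.⊖-≥ n≤m)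

[2*i]/2≡i : ∀ i → (+ 2 ℤ.* i) ℤ./ + 2 ≡ i
[2*i]/2≡i i = trans (div-pos-is-/ℕ (+ 2 ℤ.* i) 2) (sym (by-remainder _ refl (n%ℕd<d (+ 2 ℤ.* i) 2)))
  where
  q : ℤ
  q = (+ 2 ℤ.* i) ℤ./ℕ 2
  division : ∀ {r} → (+ 2 ℤ.* i) ℤ.%ℕ 2 ≡ r → + 2 ℤ.* i ≡ + r ℤ.+ q ℤ.* + 2
  division refl = a≡a%ℕn+[a/ℕn]*n (+ 2 ℤ.* i) 2
  even : ∀ q → + 0 ℤ.+ q ℤ.* + 2 ≡ + 2 ℤ.* q
  even = solve-∀
  odd : ∀ i q → + 2 ℤ.* i ℤ.- (+ 1 ℤ.+ q ℤ.* + 2) ≡ + 2 ℤ.* (i ℤ.- q) ℤ.- + 1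
  odd = solve-∀
  by-remainder : ∀ r → (+ 2 ℤ.* i) ℤ.%ℕ 2 ≡ r → r < 2 → i ≡ q
  by-remainder 0 r≡0 _ = ℤₚ.*-cancelˡ-≡ (+ 2) i q (trans (division r≡0) (even q))
  by-remainder 1 r≡1 _ = ⊥-elim (contradiction (ℕₚ.m*n≡1⇒m≡1 2 ℤ.∣ i ℤ.- q ∣ |2[i-q]|≡1))
    where
    contradiction : 2 ≢ 1
    contradiction ()
    2[i-q]≡1 : + 2 ℤ.* (i ℤ.- q) ≡ + 1
    2[i-q]≡1 = ℤₚ.i-j≡0⇒i≡j _ _ (trans (sym (odd i q)) (ℤₚ.i≡j⇒i-j≡0 (division r≡1)))
    |2[i-q]|≡1 : 2 ℕ.* ℤ.∣ i ℤ.- q ∣ ≡ 1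
    |2[i-q]|≡1 = trans (sym (ℤₚ.abs-* (+ 2) (i ℤ.- q))) (cong ℤ.∣_∣ 2[i-q]≡1)
  by-remainder (suc (suc _)) _ (s≤s (s≤s ()))

choose₂ : ℕ → ℕ
choose₂ zero    = 0
choose₂ (suc j) = choose₂ j + j

j*j-j≡2*choose₂ : ∀ j → + j ℤ.* + j ℤ.- + j ≡ + 2 ℤ.* + choose₂ j
j*j-j≡2*choose₂ zero    = refl
j*j-j≡2*choose₂ (suc j) = begin
  (1ℤ ℤ.+ + j) ℤ.* (1ℤ ℤ.+ + j) ℤ.- (1ℤ ℤ.+ + j)   ≡⟨ expand (+ j) ⟩
  (+ j ℤ.* + j ℤ.- + j) ℤ.+ + 2 ℤ.* + j           ≡⟨ cong (ℤ._+ + 2 ℤ.* + j) (j*j-j≡2*choose₂ j) ⟩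
  + 2 ℤ.* + choose₂ j ℤ.+ + 2 ℤ.* + j             ≡⟨ sym (ℤₚ.*-distribˡ-+ (+ 2) (+ choose₂ j) (+ j)) ⟩
  + 2 ℤ.* + choose₂ (suc j)                       ∎
  where
  expand : ∀ J → (1ℤ ℤ.+ J) ℤ.* (1ℤ ℤ.+ J) ℤ.- (1ℤ ℤ.+ J) ≡ (J ℤ.* J ℤ.- J) ℤ.+ + 2 ℤ.* J
  expand = solve-∀

-- q-analysis in the base t = x⁻¹

-- qfac k = (t;t)_k, qpoch D m = (t^{m+1};t)_D, qbinom c j = [c,j]_t, and qdiff D c m is the
-- c-th q-difference of m ↦ qpoch D m, a polynomial of degree D in t^m.
module QCalculus {x : ℚ} (x≢0 : x ≢ 0ℚ) where

  infix 8 t^_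

  t^_ : ℤ → ℚ
  t^ z = x ^ᶻ (ℤ.- z)

  t^-+ : ∀ a b → t^ (a ℤ.+ b) ≡ t^ a * t^ b
  t^-+ a b = trans (cong (x ^ᶻ_) (ℤₚ.neg-distrib-+ a b)) (^ᶻ-+ x≢0 (ℤ.- a) (ℤ.- b))

  qfac : ℕ → ℚ
  qfac k = prodTo k (λ l → 1ℚ -ℚ t^ + l)

  qbinom : ℕ → ℕ → ℚ
  qbinom c       zero    = 1ℚ
  qbinom zero    (suc j) = 0ℚ
  qbinom (suc c) (suc j) = qbinom c j +ℚ t^ + suc j * qbinom c (suc j)

  qbinom-> : ∀ {c j} → c < j → qbinom c j ≡ 0ℚ
  qbinom-> {zero}  {suc j} _         = refl
  qbinom-> {suc c} {suc j} (s≤s c<j) = begin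
    qbinom c j +ℚ t^ + suc j * qbinom c (suc j)   ≡⟨ cong₂ (λ u v → u +ℚ t^ + suc j * v) (qbinom-> c<j) (qbinom-> (ℕₚ.m<n⇒m<1+n c<j)) ⟩
    0ℚ +ℚ t^ + suc j * 0ℚ                         ≡⟨ cong (0ℚ +ℚ_) (ℚₚ.*-zeroʳ (t^ + suc j)) ⟩
    0ℚ                                            ∎

  qbinom-diag : ∀ j → qbinom j j ≡ 1ℚ
  qbinom-diag zero    = refl
  qbinom-diag (suc j) = begin
    qbinom j j +ℚ t^ + suc j * qbinom j (suc j)   ≡⟨ cong₂ (λ u v → u +ℚ t^ + suc j * v) (qbinom-diag j) (qbinom-> {j} ℕₚ.≤-refl) ⟩
    1ℚ +ℚ t^ + suc j * 0ℚ                         ≡⟨ cong (1ℚ +ℚ_) (ℚₚ.*-zeroʳ (t^ + suc j)) ⟩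
    1ℚ                                            ∎

  qbinom-pascal-qfac : ∀ j r A B →
    A * qfac j * qfac (suc r) ≡ qfac (suc (j + r)) → B * qfac (suc j) * qfac r ≡ qfac (suc (j + r)) →
    (A +ℚ t^ + suc j * B) * qfac (suc j) * qfac (suc r) ≡ qfac (suc (suc (j + r)))
  qbinom-pascal-qfac j r A B hA hB = begin
    (A +ℚ t * B) * (qfac j * (1ℚ -ℚ t)) * (qfac r * (1ℚ -ℚ u))
      ≡⟨ split A B t u (qfac j) (qfac r) ⟩
    A * qfac j * (qfac r * (1ℚ -ℚ u)) * (1ℚ -ℚ t) +ℚ t * (B * (qfac j * (1ℚ -ℚ t)) * qfac r) * (1ℚ -ℚ u)
      ≡⟨ cong₂ (λ a b → a * (1ℚ -ℚ t) +ℚ t * b * (1ℚ -ℚ u)) hA hB ⟩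
    Q * (1ℚ -ℚ t) +ℚ t * Q * (1ℚ -ℚ u)
      ≡⟨ merge Q t u ⟩
    Q * (1ℚ -ℚ t * u)
      ≡⟨ cong (λ v → Q * (1ℚ -ℚ v)) (sym t*u≡) ⟩
    qfac (suc (suc (j + r)))   ∎
    where
    t u Q : ℚ
    t = t^ + suc j
    u = t^ + suc r
    Q = qfac (suc (j + r))
    t*u≡ : t^ + suc (suc (j + r)) ≡ t * u
    t*u≡ = trans (cong (λ k → t^ + k) (sym (ℕₚ.+-suc (suc j) r))) (t^-+ (+ suc j) (+ suc r))
    split : ∀ A B t u Pj Pr → (A +ℚ t * B) * (Pj * (1ℚ -ℚ t)) * (Pr * (1ℚ -ℚ u))
                             ≡ A * Pj * (Pr * (1ℚ -ℚ u)) * (1ℚ -ℚ t) +ℚ t * (B * (Pj * (1ℚ -ℚ t)) * Pr) * (1ℚ -ℚ u)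
    split = solve 6 (λ A B t u Pj Pr → (A :+ t :* B) :* (Pj :* (con 1ℚ :- t)) :* (Pr :* (con 1ℚ :- u))
                       := A :* Pj :* (Pr :* (con 1ℚ :- u)) :* (con 1ℚ :- t) :+ t :* (B :* (Pj :* (con 1ℚ :- t)) :* Pr) :* (con 1ℚ :- u)) refl
    merge : ∀ Q t u → Q * (1ℚ -ℚ t) +ℚ t * Q * (1ℚ -ℚ u) ≡ Q * (1ℚ -ℚ t * u)
    merge = solve 3 (λ Q t u → Q :* (con 1ℚ :- t) :+ t :* Q :* (con 1ℚ :- u) := Q :* (con 1ℚ :- t :* u)) refl

  qbinom*qfac*qfac : ∀ j r → qbinom (j + r) j * qfac j * qfac r ≡ qfac (j + r)
  qbinom*qfac*qfac zero          r    = ℚₚ.*-identityˡ (qfac r)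
  qbinom*qfac*qfac (suc j)       zero rewrite ℕₚ.+-identityʳ j =
    trans (cong (λ u → u * qfac (suc j) * 1ℚ) (qbinom-diag (suc j)))
          (trans (ℚₚ.*-identityʳ (1ℚ * qfac (suc j))) (ℚₚ.*-identityˡ (qfac (suc j))))
  qbinom*qfac*qfac (suc j) (suc r) rewrite ℕₚ.+-suc j r =
    qbinom-pascal-qfac j r (qbinom (suc (j + r)) j) (qbinom (suc (j + r)) (suc j))
      (subst (λ k → qbinom k j * qfac j * qfac (suc r) ≡ qfac k) (ℕₚ.+-suc j r) (qbinom*qfac*qfac j (suc r)))
      (qbinom*qfac*qfac (suc j) r)

  qpoch : ℕ → ℤ → ℚ
  qpoch D m = prodTo D (λ k → 1ℚ -ℚ t^ (m ℤ.+ + k))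

  qfac*qpoch : ∀ H D → qfac H * qpoch D (+ H) ≡ qfac (H + D)
  qfac*qpoch H zero    = trans (ℚₚ.*-identityʳ (qfac H)) (cong qfac (sym (ℕₚ.+-identityʳ H)))
  qfac*qpoch H (suc D) = begin
    qfac H * (qpoch D (+ H) * (1ℚ -ℚ t^ + (H + suc D)))   ≡⟨ sym (ℚₚ.*-assoc (qfac H) _ _) ⟩
    qfac H * qpoch D (+ H) * (1ℚ -ℚ t^ + (H + suc D))     ≡⟨ cong₂ (λ a k → a * (1ℚ -ℚ t^ + k)) (qfac*qpoch H D) (ℕₚ.+-suc H D) ⟩
    qfac (H + D) * (1ℚ -ℚ t^ + suc (H + D))              ≡⟨ cong qfac (sym (ℕₚ.+-suc H D)) ⟩
    qfac (H + suc D)                                     ∎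

  qpoch-diff : ∀ D μ → qpoch (suc D) μ -ℚ qpoch (suc D) (μ ℤ.- 1ℤ) ≡ t^ μ * (1ℚ -ℚ t^ + suc D) * qpoch D μ
  qpoch-diff D μ = begin
    qpoch D μ * (1ℚ -ℚ t^ (μ ℤ.+ + suc D)) -ℚ qpoch (suc D) (μ ℤ.- 1ℤ)
      ≡⟨ cong₂ (λ a b → qpoch D μ * (1ℚ -ℚ a) -ℚ b) (t^-+ μ (+ suc D)) shifted ⟩
    qpoch D μ * (1ℚ -ℚ t^ μ * t^ + suc D) -ℚ (1ℚ -ℚ t^ μ) * qpoch D μ
      ≡⟨ factor (qpoch D μ) (t^ μ) (t^ + suc D) ⟩
    t^ μ * (1ℚ -ℚ t^ + suc D) * qpoch D μ   ∎
    where
    shifted : qpoch (suc D) (μ ℤ.- 1ℤ) ≡ (1ℚ -ℚ t^ μ) * qpoch D μ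
    shifted = trans (prodTo-suc D (λ k → 1ℚ -ℚ t^ (μ ℤ.- 1ℤ ℤ.+ + k)))
                    (cong₂ _*_ (cong (λ z → 1ℚ -ℚ t^ z) (cancel μ))
                               (prodTo-cong D (λ k → cong (λ z → 1ℚ -ℚ t^ z) (reassoc μ (+ k)))))
      where
      cancel : ∀ μ → μ ℤ.- 1ℤ ℤ.+ 1ℤ ≡ μ
      cancel = solve-∀
      reassoc : ∀ μ k → μ ℤ.- 1ℤ ℤ.+ (1ℤ ℤ.+ k) ≡ μ ℤ.+ k
      reassoc = solve-∀
    factor : ∀ G a b → G * (1ℚ -ℚ a * b) -ℚ (1ℚ -ℚ a) * G ≡ a * (1ℚ -ℚ b) * G
    factor = solve 3 (λ G a b → G :* (con 1ℚ :- a :* b) :- (con 1ℚ :- a) :* G := a :* (con 1ℚ :- b) :* G) refl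

  qpoch-≡0 : ∀ D {e} → 1 ≤ e → e ≤ D → qpoch D (ℤ.- + e) ≡ 0ℚ
  qpoch-≡0 D {e} 1≤e e≤D = prodTo-≡0 D _ 1≤e e≤D (begin
    1ℚ -ℚ t^ (ℤ.- + e ℤ.+ + e)   ≡⟨ cong (λ z → 1ℚ -ℚ t^ z) (ℤₚ.+-inverseˡ (+ e)) ⟩
    1ℚ -ℚ 1ℚ                     ≡⟨ ℚₚ.+-inverseʳ 1ℚ ⟩
    0ℚ                           ∎)

  qdiffTerm : ℕ → ℤ → ℕ → ℚ
  qdiffTerm D m j = sgn (+ j) * t^ + choose₂ j * qpoch D (m ℤ.- + j)

  qdiff : ℕ → ℕ → ℤ → ℚ
  qdiff D c m = ∑< (suc c) (λ j → qbinom c j * qdiffTerm D m j)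

  qdiffTerm-step₀ : ∀ m j → qdiffTerm 0 m (suc j) +ℚ t^ + j * qdiffTerm 0 m j ≡ 0ℚ
  qdiffTerm-step₀ m j = begin
    -1ℚ * s * t^ (+ choose₂ j ℤ.+ + j) * 1ℚ +ℚ t^ + j * (s * t^ + choose₂ j * 1ℚ)
      ≡⟨ cong (λ a → -1ℚ * s * a * 1ℚ +ℚ t^ + j * (s * t^ + choose₂ j * 1ℚ)) (t^-+ (+ choose₂ j) (+ j)) ⟩
    -1ℚ * s * (t^ + choose₂ j * t^ + j) * 1ℚ +ℚ t^ + j * (s * t^ + choose₂ j * 1ℚ)
      ≡⟨ cancel s (t^ + choose₂ j) (t^ + j) ⟩
    0ℚ   ∎
    where
    s : ℚ
    s = sgn (+ j)
    cancel : ∀ s a b → -1ℚ * s * (a * b) * 1ℚ +ℚ b * (s * a * 1ℚ) ≡ 0ℚ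
    cancel = solve 3 (λ s a b → con -1ℚ :* s :* (a :* b) :* con 1ℚ :+ b :* (s :* a :* con 1ℚ) := con 0ℚ) refl

  qdiffTerm-step : ∀ D m j → qdiffTerm (suc D) m (suc j) +ℚ t^ + j * qdiffTerm (suc D) m j
                             ≡ t^ m * (1ℚ -ℚ t^ + suc D) * qdiffTerm D m j
  qdiffTerm-step D m j = begin
    -1ℚ * s * t^ (+ choose₂ j ℤ.+ + j) * qpoch (suc D) (m ℤ.- (1ℤ ℤ.+ + j)) +ℚ t^ + j * (s * t^ + choose₂ j * A)
      ≡⟨ cong₂ (λ a z → -1ℚ * s * a * qpoch (suc D) z +ℚ t^ + j * (s * t^ + choose₂ j * A))
               (t^-+ (+ choose₂ j) (+ j)) (reassoc m (+ j)) ⟩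
    -1ℚ * s * (t^ + choose₂ j * t^ + j) * B +ℚ t^ + j * (s * t^ + choose₂ j * A)
      ≡⟨ collect s (t^ + choose₂ j) (t^ + j) A B ⟩
    s * t^ + choose₂ j * t^ + j * (A -ℚ B)
      ≡⟨ cong (s * t^ + choose₂ j * t^ + j *_) (qpoch-diff D μ) ⟩
    s * t^ + choose₂ j * t^ + j * (t^ μ * K * qpoch D μ)
      ≡⟨ regroup s (t^ + choose₂ j) (t^ + j) (t^ μ) K (qpoch D μ) ⟩
    t^ + j * t^ μ * K * qdiffTerm D m j
      ≡⟨ cong (λ a → a * K * qdiffTerm D m j) (trans (sym (t^-+ (+ j) μ)) (cong t^_ (j+[m-j]≡m m (+ j)))) ⟩
    t^ m * K * qdiffTerm D m j   ∎
    where
    s K A B : ℚ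
    μ : ℤ
    s = sgn (+ j)
    K = 1ℚ -ℚ t^ + suc D
    μ = m ℤ.- + j
    A = qpoch (suc D) μ
    B = qpoch (suc D) (μ ℤ.- 1ℤ)
    reassoc : ∀ m j → m ℤ.- (1ℤ ℤ.+ j) ≡ m ℤ.- j ℤ.- 1ℤ
    reassoc = solve-∀
    j+[m-j]≡m : ∀ m j → j ℤ.+ (m ℤ.- j) ≡ m
    j+[m-j]≡m = solve-∀
    collect : ∀ s a b A B → -1ℚ * s * (a * b) * B +ℚ b * (s * a * A) ≡ s * a * b * (A -ℚ B)
    collect = solve 5 (λ s a b A B → con -1ℚ :* s :* (a :* b) :* B :+ b :* (s :* a :* A) := s :* a :* b :* (A :- B)) refl
    regroup : ∀ s a b c K G → s * a * b * (c * K * G) ≡ b * c * K * (s * a * G)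
    regroup = solve 6 (λ s a b c K G → s :* a :* b :* (c :* K :* G) := b :* c :* K :* (s :* a :* G)) refl

  ∑-qbinom-pascal : ∀ c (w : ℕ → ℚ) → ∑< (suc (suc c)) (λ j → qbinom (suc c) j * w j)
                                      ≡ ∑< (suc c) (λ j → qbinom c j * (w (suc j) +ℚ t^ + j * w j))
  ∑-qbinom-pascal c w = begin
    ∑< (suc (suc c)) (λ j → qbinom (suc c) j * w j)
      ≡⟨ ∑<-suc (suc c) (λ j → qbinom (suc c) j * w j) ⟩
    1ℚ * w 0 +ℚ ∑< (suc c) (λ j → (qbinom c j +ℚ t^ + suc j * qbinom c (suc j)) * w (suc j))
      ≡⟨ cong₂ _+ℚ_ (cong (1ℚ *_) (sym (ℚₚ.*-identityˡ (w 0))))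
                    (trans (∑<-cong (suc c) (λ j _ → distrib (qbinom c j) (t^ + suc j) (qbinom c (suc j)) (w (suc j))))
                           (∑<-+ (suc c) (λ j → qbinom c j * w (suc j)) (λ j → h (suc j)))) ⟩
    h 0 +ℚ (A +ℚ ∑< (suc c) (λ j → h (suc j)))
      ≡⟨ +-x∙yz≈y∙xz (h 0) A _ ⟩
    A +ℚ (h 0 +ℚ ∑< (suc c) (λ j → h (suc j)))
      ≡⟨ cong (A +ℚ_) (sym (∑<-suc (suc c) h)) ⟩
    A +ℚ (∑< (suc c) h +ℚ h (suc c))
      ≡⟨ cong (λ v → A +ℚ (∑< (suc c) h +ℚ t^ + suc c * (v * w (suc c)))) (qbinom-> {c} ℕₚ.≤-refl) ⟩
    A +ℚ (∑< (suc c) h +ℚ t^ + suc c * (0ℚ * w (suc c)))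
      ≡⟨ cong (λ v → A +ℚ (∑< (suc c) h +ℚ v)) (trans (cong (t^ + suc c *_) (ℚₚ.*-zeroˡ (w (suc c)))) (ℚₚ.*-zeroʳ (t^ + suc c))) ⟩
    A +ℚ (∑< (suc c) h +ℚ 0ℚ)
      ≡⟨ cong (A +ℚ_) (ℚₚ.+-identityʳ _) ⟩
    A +ℚ ∑< (suc c) h
      ≡⟨ sym (∑<-+ (suc c) (λ j → qbinom c j * w (suc j)) h) ⟩
    ∑< (suc c) (λ j → qbinom c j * w (suc j) +ℚ h j)
      ≡⟨ ∑<-cong (suc c) (λ j _ → factor (qbinom c j) (w (suc j)) (t^ + j) (w j)) ⟩
    ∑< (suc c) (λ j → qbinom c j * (w (suc j) +ℚ t^ + j * w j))   ∎
    where
    h : ℕ → ℚ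
    h j = t^ + j * (qbinom c j * w j)
    A : ℚ
    A = ∑< (suc c) (λ j → qbinom c j * w (suc j))
    distrib : ∀ a t b w → (a +ℚ t * b) * w ≡ a * w +ℚ t * (b * w)
    distrib = solve 4 (λ a t b w → (a :+ t :* b) :* w := a :* w :+ t :* (b :* w)) refl
    factor : ∀ a v t w → a * v +ℚ t * (a * w) ≡ a * (v +ℚ t * w)
    factor = solve 4 (λ a v t w → a :* v :+ t :* (a :* w) := a :* (v :+ t :* w)) refl

  qdiff-suc-suc : ∀ D c m → qdiff (suc D) (suc c) m ≡ t^ m * (1ℚ -ℚ t^ + suc D) * qdiff D c m
  qdiff-suc-suc D c m = begin
    qdiff (suc D) (suc c) m
      ≡⟨ ∑-qbinom-pascal c (qdiffTerm (suc D) m) ⟩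
    ∑< (suc c) (λ j → qbinom c j * (qdiffTerm (suc D) m (suc j) +ℚ t^ + j * qdiffTerm (suc D) m j))
      ≡⟨ ∑<-cong (suc c) (λ j _ → trans (cong (qbinom c j *_) (qdiffTerm-step D m j)) (*-x∙yz≈y∙xz (qbinom c j) K _)) ⟩
    ∑< (suc c) (λ j → K * (qbinom c j * qdiffTerm D m j))
      ≡⟨ sym (*-distribˡ-∑< (suc c) K _) ⟩
    K * qdiff D c m   ∎
    where
    K : ℚ
    K = t^ m * (1ℚ -ℚ t^ + suc D)

  qdiff-vanishes : ∀ D c m → D < c → qdiff D c m ≡ 0ℚ
  qdiff-vanishes zero    (suc c) m _         = trans (∑-qbinom-pascal c (qdiffTerm 0 m))
    (∑<-0 (suc c) _ (λ j _ → trans (cong (qbinom c j *_) (qdiffTerm-step₀ m j)) (ℚₚ.*-zeroʳ (qbinom c j))))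
  qdiff-vanishes (suc D) (suc c) m (s≤s D<c) = trans (qdiff-suc-suc D c m)
    (trans (cong (K *_) (qdiff-vanishes D c m D<c)) (ℚₚ.*-zeroʳ K))
    where
    K : ℚ
    K = t^ m * (1ℚ -ℚ t^ + suc D)

  qdiff-closed : ∀ D c m → c ≤ D → qdiff D c m * qfac (D ∸ c) ≡ t^ (+ c ℤ.* m) * qfac D * qpoch (D ∸ c) m
  qdiff-closed D       zero    m _         = begin
    (0ℚ +ℚ 1ℚ * (1ℚ * 1ℚ * qpoch D (m ℤ.- + 0))) * qfac D
      ≡⟨ cong (λ z → (0ℚ +ℚ 1ℚ * (1ℚ * 1ℚ * qpoch D z)) * qfac D) (ℤₚ.+-identityʳ m) ⟩
    (0ℚ +ℚ 1ℚ * (1ℚ * 1ℚ * qpoch D m)) * qfac D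
      ≡⟨ simplify (qpoch D m) (qfac D) ⟩
    1ℚ * qfac D * qpoch D m   ∎
    where
    simplify : ∀ G P → (0ℚ +ℚ 1ℚ * (1ℚ * 1ℚ * G)) * P ≡ 1ℚ * P * G
    simplify = solve 2 (λ G P → (con 0ℚ :+ con 1ℚ :* (con 1ℚ :* con 1ℚ :* G)) :* P := con 1ℚ :* P :* G) refl
  qdiff-closed (suc D) (suc c) m (s≤s c≤D) = begin
    qdiff (suc D) (suc c) m * qfac (D ∸ c)
      ≡⟨ cong (_* qfac (D ∸ c)) (qdiff-suc-suc D c m) ⟩
    t^ m * K * qdiff D c m * qfac (D ∸ c)
      ≡⟨ ℚₚ.*-assoc (t^ m * K) _ _ ⟩
    t^ m * K * (qdiff D c m * qfac (D ∸ c))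
      ≡⟨ cong (t^ m * K *_) (qdiff-closed D c m c≤D) ⟩
    t^ m * K * (t^ (+ c ℤ.* m) * qfac D * qpoch (D ∸ c) m)
      ≡⟨ regroup (t^ m) K (t^ (+ c ℤ.* m)) (qfac D) (qpoch (D ∸ c) m) ⟩
    t^ m * t^ (+ c ℤ.* m) * (qfac D * K) * qpoch (D ∸ c) m
      ≡⟨ cong (λ a → a * (qfac D * K) * qpoch (D ∸ c) m) (trans (sym (t^-+ m (+ c ℤ.* m))) (cong t^_ (sym (distrib (+ c) m)))) ⟩
    t^ (+ suc c ℤ.* m) * qfac (suc D) * qpoch (D ∸ c) m   ∎
    where
    K : ℚ
    K = 1ℚ -ℚ t^ + suc D
    regroup : ∀ a K b P G → a * K * (b * P * G) ≡ a * b * (P * K) * G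
    regroup = solve 5 (λ a K b P G → a :* K :* (b :* P :* G) := a :* b :* (P :* K) :* G) refl
    distrib : ∀ c m → (1ℤ ℤ.+ c) ℤ.* m ≡ m ℤ.+ c ℤ.* m
    distrib = solve-∀

  1-x^-product : ∀ m → prodTo m (λ i → 1ℚ -ℚ x ^ℚ i) ≡ sgn (+ m) * x ^ᶻ + choose₂ (suc m) * qfac m
  1-x^-product zero    = refl
  1-x^-product (suc m) = begin
    prodTo m (λ i → 1ℚ -ℚ x ^ℚ i) * (1ℚ -ℚ X)
      ≡⟨ cong (_* (1ℚ -ℚ X)) (1-x^-product m) ⟩
    s * p * qfac m * (1ℚ -ℚ X)
      ≡⟨ reflect s p (qfac m) X (t^ + suc m) ⟩
    -1ℚ * s * (p * X) * (qfac m * (1ℚ -ℚ t^ + suc m)) +ℚ s * p * qfac m * (1ℚ -ℚ X * t^ + suc m)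
      ≡⟨ cong₂ (λ u v → -1ℚ * s * u * qfac (suc m) +ℚ s * p * qfac m * (1ℚ -ℚ v))
               (sym (^ᶻ-+ x≢0 (+ choose₂ (suc m)) (+ suc m))) X*t^≡1 ⟩
    -1ℚ * s * x ^ᶻ + choose₂ (suc (suc m)) * qfac (suc m) +ℚ s * p * qfac m * (1ℚ -ℚ 1ℚ)
      ≡⟨ drop (-1ℚ * s * x ^ᶻ + choose₂ (suc (suc m)) * qfac (suc m)) (s * p * qfac m) ⟩
    sgn (+ suc m) * x ^ᶻ + choose₂ (suc (suc m)) * qfac (suc m)   ∎
    where
    s p X : ℚ
    s = sgn (+ m)
    p = x ^ᶻ + choose₂ (suc m)
    X = x ^ℚ suc m
    X*t^≡1 : X * t^ + suc m ≡ 1ℚ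
    X*t^≡1 = trans (cong (X *_) (^ᶻ-negsuc x m)) (*-invʳ (^ℚ-≢0 x≢0 (suc m)))
    reflect : ∀ s p P X Y → s * p * P * (1ℚ -ℚ X) ≡ -1ℚ * s * (p * X) * (P * (1ℚ -ℚ Y)) +ℚ s * p * P * (1ℚ -ℚ X * Y)
    reflect = solve 5 (λ s p P X Y → s :* p :* P :* (con 1ℚ :- X)
                         := con -1ℚ :* s :* (p :* X) :* (P :* (con 1ℚ :- Y)) :+ s :* p :* P :* (con 1ℚ :- X :* Y)) refl
    drop : ∀ a b → a +ℚ b * (1ℚ -ℚ 1ℚ) ≡ a
    drop = solve 2 (λ a b → a :+ b :* (con 1ℚ :- con 1ℚ) := a) refl

-- The base x = -q

pw≡negq^ᶻ : ∀ q z → pw q z ≡ negq q ^ᶻ z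
pw≡negq^ᶻ q (+ k)      = refl
pw≡negq^ᶻ q -[1+ k ]   = refl

module NegativeQ {q : ℕ} (2≤q : 2 ≤ q) where

  toℚᵘ-negq^ : ∀ k → ℚ.toℚᵘ (negq q ^ℚ k) ℚᵘ.≃ ℚᵘ.mkℚᵘ ((ℤ.- + q) ℤ.^ k) 0
  toℚᵘ-negq^ zero    = ℚᵘₚ.≃-refl
  toℚᵘ-negq^ (suc k) = ℚᵘₚ.≃-trans (ℚₚ.toℚᵘ-homo-* (negq q) (negq q ^ℚ k)) (ℚᵘₚ.*-cong toℚᵘ-negq (toℚᵘ-negq^ k))
    where
    toℚᵘ-negq : ℚ.toℚᵘ (negq q) ℚᵘ.≃ ℚᵘ.mkℚᵘ (ℤ.- + q) 0
    toℚᵘ-negq = ℚᵘₚ.≃-trans (ℚₚ.toℚᵘ-homo‿- (+ q ℚ./ 1)) (ℚᵘₚ.-‿cong (ℚₚ.toℚᵘ-fromℚᵘ (ℚᵘ.mkℚᵘ (+ q) 0)))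

  ∣-q^k∣≡q^k : ∀ k → ℤ.∣ (ℤ.- + q) ℤ.^ k ∣ ≡ q ℕ.^ k
  ∣-q^k∣≡q^k zero    = refl
  ∣-q^k∣≡q^k (suc k) = trans (ℤₚ.abs-* (ℤ.- + q) _) (cong₂ ℕ._*_ (ℤₚ.∣-i∣≡∣i∣ (+ q)) (∣-q^k∣≡q^k k))

  negq^k≃r⇒q^k≡r : ∀ k {y r} → negq q ^ℚ k ≡ y → ℚ.toℚᵘ y ℚᵘ.≃ ℚᵘ.mkℚᵘ (+ r) 0 → q ℕ.^ k ≡ r
  negq^k≃r⇒q^k≡r k {r = r} e y≃r with ℚᵘₚ.≃-trans (ℚᵘₚ.≃-sym (toℚᵘ-negq^ k)) (ℚᵘₚ.≃-trans (ℚₚ.toℚᵘ-cong e) y≃r)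
  ... | ℚᵘ.*≡* num≡ = begin
    q ℕ.^ k                                    ≡⟨ sym (∣-q^k∣≡q^k k) ⟩
    ℤ.∣ (ℤ.- + q) ℤ.^ k ∣                      ≡⟨ cong ℤ.∣_∣ (sym (ℤₚ.*-identityʳ ((ℤ.- + q) ℤ.^ k))) ⟩
    ℤ.∣ (ℤ.- + q) ℤ.^ k ℤ.* + 1 ∣              ≡⟨ cong ℤ.∣_∣ num≡ ⟩
    ℤ.∣ + r ℤ.* + 1 ∣                          ≡⟨ cong ℤ.∣_∣ (ℤₚ.*-identityʳ (+ r)) ⟩
    r                                          ∎

  negq≢0 : negq q ≢ 0ℚ
  negq≢0 e = ℕₚ.<⇒≢ (ℕₚ.<-trans (s≤s ℕ.z≤n) 2≤q)
    (sym (trans (sym (ℕₚ.*-identityʳ q)) (negq^k≃r⇒q^k≡r 1 (trans (cong (_* 1ℚ) e) (ℚₚ.*-zeroˡ 1ℚ)) ℚᵘₚ.≃-refl)))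

  negq^suc≢1 : ∀ k → negq q ^ℚ suc k ≢ 1ℚ
  negq^suc≢1 k e with ℕₚ.m^n≡1⇒n≡0∨m≡1 q (suc k) (negq^k≃r⇒q^k≡r (suc k) e ℚᵘₚ.≃-refl)
  ... | inj₂ q≡1 = ℕₚ.<⇒≢ 2≤q (sym q≡1)

  open QCalculus negq≢0 public

  qfac-≢0 : ∀ k → qfac k ≢ 0ℚ
  qfac-≢0 zero    = ℚₚ.1≢0
  qfac-≢0 (suc k) = *-≢0 (qfac-≢0 k) 1-t^≢0
    where
    X : ℚ
    X = negq q ^ℚ suc k
    1-t^≢0 : 1ℚ -ℚ t^ + suc k ≢ 0ℚ
    1-t^≢0 e = negq^suc≢1 k (begin
      X               ≡⟨ sym (ℚₚ.*-identityʳ X) ⟩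
      X * 1ℚ          ≡⟨ cong (X *_) (trans (x∙y⁻¹≈ε⇒x≈y 1ℚ (t^ + suc k) e) (^ᶻ-negsuc (negq q) k)) ⟩
      X * inv X       ≡⟨ *-invʳ (^ℚ-≢0 negq≢0 (suc k)) ⟩
      1ℚ              ∎)

  P≡qfac : ∀ k → P q (+ k) ≡ qfac k
  P≡qfac k = prodTo-cong k (λ l → cong (1ℚ -ℚ_) (pw≡negq^ᶻ q (ℤ.- + l)))

  P-diff : ∀ {m n k} → n ≤ m → m ∸ n ≡ k → P q (+ m ℤ.- + n) ≡ qfac k
  P-diff {m} {n} n≤m refl = trans (cong (P q) (+m-+n≡+[m∸n] n≤m)) (P≡qfac (m ∸ n))

  qfac*Pfrom : ∀ {s h} → s ≤ h → qfac s * Pfrom q s h ≡ qfac h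
  qfac*Pfrom {s} {h} s≤h = begin
    qfac s * Pfrom q s h            ≡⟨ cong (qfac s *_) (prodTo-cong (h ∸ s) (λ l → cong (1ℚ -ℚ_) (pw≡negq^ᶻ q (ℤ.- + (s + l))))) ⟩
    qfac s * qpoch (h ∸ s) (+ s)    ≡⟨ qfac*qpoch s (h ∸ s) ⟩
    qfac (s + (h ∸ s))              ≡⟨ cong qfac (ℕₚ.m+[n∸m]≡n s≤h) ⟩
    qfac h                          ∎

-- The sum of Lemma 9.1

Cc-product : ∀ {q} j a b c {m} → a + b ≡ suc m → Cc q j a b c ≡ sgn (j ℤ.+ 1ℤ) * prodTo m (λ i → 1ℚ -ℚ negq q ^ℚ i)
Cc-product j a b c a+b≡1+m with a + b | a+b≡1+m
... | .(suc _) | refl = refl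

-- the exponents of -q in Defs.M and Defs.RHS1, and E₀ = M-exponent N H S S C
M-exponent : (N H I S C : ℤ) → ℤ
M-exponent N H I S C =
  N ℤ.* (H ℤ.- I) ℤ.+ ((I ℤ.- S) ℤ.* (+ 2 ℤ.* N ℤ.- I ℤ.+ S ℤ.+ 1ℤ)) ℤ./ (+ 2) ℤ.- H ℤ.* H
  ℤ.+ S ℤ.* (+ 2 ℤ.* N ℤ.- + 2 ℤ.* C ℤ.- S)

RHS1-exponent : (N H S C : ℤ) → ℤ
RHS1-exponent N H S C =
  (C ℤ.+ C ℤ.* C ℤ.- N ℤ.+ N ℤ.* N ℤ.+ S ℤ.- S ℤ.* S) ℤ./ (+ 2) ℤ.- H ℤ.* H ℤ.- C ℤ.* N ℤ.+ H ℤ.* N ℤ.- C ℤ.* H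

E₀ : (N H S C : ℤ) → ℤ
E₀ N H S C = N ℤ.* (H ℤ.- S) ℤ.- H ℤ.* H ℤ.+ S ℤ.* (+ 2 ℤ.* N ℤ.- + 2 ℤ.* C ℤ.- S)

M-exponent-at : ∀ N H S C J T → J ℤ.* J ℤ.- J ≡ + 2 ℤ.* T → M-exponent N H (S ℤ.+ J) S C ≡ E₀ N H S C ℤ.- T
M-exponent-at N H S C J T J²-J≡2T = begin
  M-exponent N H (S ℤ.+ J) S C
    ≡⟨ cong (λ z → N ℤ.* (H ℤ.- (S ℤ.+ J)) ℤ.+ z ℤ.- H ℤ.* H ℤ.+ S ℤ.* (+ 2 ℤ.* N ℤ.- + 2 ℤ.* C ℤ.- S)) halved ⟩
  N ℤ.* (H ℤ.- (S ℤ.+ J)) ℤ.+ (N ℤ.* J ℤ.- T) ℤ.- H ℤ.* H ℤ.+ S ℤ.* (+ 2 ℤ.* N ℤ.- + 2 ℤ.* C ℤ.- S)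
    ≡⟨ collect N H S C J T ⟩
  E₀ N H S C ℤ.- T   ∎
  where
  expand : ∀ N S J → (S ℤ.+ J ℤ.- S) ℤ.* (+ 2 ℤ.* N ℤ.- (S ℤ.+ J) ℤ.+ S ℤ.+ 1ℤ) ≡ + 2 ℤ.* (N ℤ.* J) ℤ.- (J ℤ.* J ℤ.- J)
  expand = solve-∀
  factor : ∀ N J T → + 2 ℤ.* (N ℤ.* J) ℤ.- + 2 ℤ.* T ≡ + 2 ℤ.* (N ℤ.* J ℤ.- T)
  factor = solve-∀
  collect : ∀ N H S C J T → N ℤ.* (H ℤ.- (S ℤ.+ J)) ℤ.+ (N ℤ.* J ℤ.- T) ℤ.- H ℤ.* H ℤ.+ S ℤ.* (+ 2 ℤ.* N ℤ.- + 2 ℤ.* C ℤ.- S)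
                            ≡ (N ℤ.* (H ℤ.- S) ℤ.- H ℤ.* H ℤ.+ S ℤ.* (+ 2 ℤ.* N ℤ.- + 2 ℤ.* C ℤ.- S)) ℤ.- T
  collect = solve-∀
  halved : (S ℤ.+ J ℤ.- S) ℤ.* (+ 2 ℤ.* N ℤ.- (S ℤ.+ J) ℤ.+ S ℤ.+ 1ℤ) ℤ./ + 2 ≡ N ℤ.* J ℤ.- T
  halved = trans (cong (ℤ._/ + 2) (trans (expand N S J) (trans (cong (λ u → + 2 ℤ.* (N ℤ.* J) ℤ.- u) J²-J≡2T) (factor N J T))))
                 ([2*i]/2≡i (N ℤ.* J ℤ.- T))

RHS1-exponent≡ : ∀ N H S C T → (N ℤ.- C ℤ.- S) ℤ.* (N ℤ.- C ℤ.- S) ℤ.- (N ℤ.- C ℤ.- S) ≡ + 2 ℤ.* T →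
                 RHS1-exponent N H S C ≡ E₀ N H S C ℤ.+ T ℤ.- C ℤ.* (H ℤ.- S)
RHS1-exponent≡ N H S C T M²-M≡2T = begin
  RHS1-exponent N H S C
    ≡⟨ cong (λ z → z ℤ.- H ℤ.* H ℤ.- C ℤ.* N ℤ.+ H ℤ.* N ℤ.- C ℤ.* H) (trans (cong (ℤ._/ + 2) numerator) ([2*i]/2≡i (W ℤ.+ T))) ⟩
  W ℤ.+ T ℤ.- H ℤ.* H ℤ.- C ℤ.* N ℤ.+ H ℤ.* N ℤ.- C ℤ.* H
    ≡⟨ collect (E₀ N H S C) N H S C T ⟩
  E₀ N H S C ℤ.+ T ℤ.- C ℤ.* (H ℤ.- S)   ∎
  where
  W : ℤ
  W = E₀ N H S C ℤ.- C ℤ.* (H ℤ.- S) ℤ.+ H ℤ.* H ℤ.+ C ℤ.* N ℤ.- H ℤ.* N ℤ.+ C ℤ.* H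
  expand : ∀ N H S C → C ℤ.+ C ℤ.* C ℤ.- N ℤ.+ N ℤ.* N ℤ.+ S ℤ.- S ℤ.* S
                       ≡ + 2 ℤ.* ((N ℤ.* (H ℤ.- S) ℤ.- H ℤ.* H ℤ.+ S ℤ.* (+ 2 ℤ.* N ℤ.- + 2 ℤ.* C ℤ.- S)) ℤ.- C ℤ.* (H ℤ.- S) ℤ.+ H ℤ.* H ℤ.+ C ℤ.* N ℤ.- H ℤ.* N ℤ.+ C ℤ.* H)
                         ℤ.+ ((N ℤ.- C ℤ.- S) ℤ.* (N ℤ.- C ℤ.- S) ℤ.- (N ℤ.- C ℤ.- S))
  expand = solve-∀
  factor : ∀ W T → + 2 ℤ.* W ℤ.+ + 2 ℤ.* T ≡ + 2 ℤ.* (W ℤ.+ T)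
  factor = solve-∀
  numerator : C ℤ.+ C ℤ.* C ℤ.- N ℤ.+ N ℤ.* N ℤ.+ S ℤ.- S ℤ.* S ≡ + 2 ℤ.* (W ℤ.+ T)
  numerator = trans (expand N H S C) (trans (cong (λ u → + 2 ℤ.* W ℤ.+ u) M²-M≡2T) (factor W T))
  collect : ∀ E N H S C T → E ℤ.- C ℤ.* (H ℤ.- S) ℤ.+ H ℤ.* H ℤ.+ C ℤ.* N ℤ.- H ℤ.* N ℤ.+ C ℤ.* H ℤ.+ T
                            ℤ.- H ℤ.* H ℤ.- C ℤ.* N ℤ.+ H ℤ.* N ℤ.- C ℤ.* H
                            ≡ E ℤ.+ T ℤ.- C ℤ.* (H ℤ.- S)
  collect = solve-∀

sgn-collect : ∀ N H S C → sgn (S ℤ.+ H) * sgn (H ℤ.+ 1ℤ ℤ.- S ℤ.+ 1ℤ) * sgn (N ℤ.- C ℤ.- S ℤ.- 1ℤ)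
                          ≡ sgn (N ℤ.+ C ℤ.+ S ℤ.+ 1ℤ)
sgn-collect N H S C = begin
  sgn A * sgn B * sgn E              ≡⟨ cong (_* sgn E) (sym (sgn-+ A B)) ⟩
  sgn (A ℤ.+ B) * sgn E              ≡⟨ sym (sgn-+ (A ℤ.+ B) E) ⟩
  sgn (A ℤ.+ B ℤ.+ E)                ≡⟨ cong sgn (regroup N H S C) ⟩
  sgn (R ℤ.+ (Y ℤ.+ Y))              ≡⟨ sgn-+ R (Y ℤ.+ Y) ⟩
  sgn R * sgn (Y ℤ.+ Y)              ≡⟨ cong (sgn R *_) (sgn-double Y) ⟩
  sgn R * 1ℚ                         ≡⟨ ℚₚ.*-identityʳ (sgn R) ⟩
  sgn R                              ∎
  where
  A B E R Y : ℤ
  A = S ℤ.+ H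
  B = H ℤ.+ 1ℤ ℤ.- S ℤ.+ 1ℤ
  E = N ℤ.- C ℤ.- S ℤ.- 1ℤ
  R = N ℤ.+ C ℤ.+ S ℤ.+ 1ℤ
  Y = H ℤ.- C ℤ.- S
  regroup : ∀ N H S C → S ℤ.+ H ℤ.+ (H ℤ.+ 1ℤ ℤ.- S ℤ.+ 1ℤ) ℤ.+ (N ℤ.- C ℤ.- S ℤ.- 1ℤ)
                        ≡ N ℤ.+ C ℤ.+ S ℤ.+ 1ℤ ℤ.+ (H ℤ.- C ℤ.- S ℤ.+ (H ℤ.- C ℤ.- S))
  regroup = solve-∀

module Lemma9p1Sum {q : ℕ} (2≤q : 2 ≤ q) {n a b c h s m : ℕ} (a+b+c≡n : a + b + c ≡ n)
                   (s≤h : s ≤ h) (s≤b : s ≤ b) (h≤n : h ≤ n) (a+[b∸s]≡1+m : a + (b ∸ s) ≡ suc m) where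

  open NegativeQ 2≤q

  H D L : ℕ
  H = h ∸ s
  D = n ∸ h
  L = c ⊓ H

  n≡1+m+[s+c] : n ≡ suc m + (s + c)
  n≡1+m+[s+c] = begin
    n                        ≡⟨ sym a+b+c≡n ⟩
    a + b + c                ≡⟨ cong (λ k → a + k + c) (sym (ℕₚ.m∸n+n≡m s≤b)) ⟩
    a + (b ∸ s + s) + c      ≡⟨ cong (_+ c) (sym (ℕₚ.+-assoc a (b ∸ s) s)) ⟩
    a + (b ∸ s) + s + c      ≡⟨ cong (λ k → k + s + c) a+[b∸s]≡1+m ⟩
    suc m + s + c            ≡⟨ ℕₚ.+-assoc (suc m) s c ⟩
    suc m + (s + c)          ∎

  H+D≡n∸s : H + D ≡ n ∸ s
  H+D≡n∸s = begin
    H + D                    ≡⟨ sym (ℕₚ.m+n∸m≡n s (H + D)) ⟩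
    s + (H + D) ∸ s          ≡⟨ cong (_∸ s) (sym (ℕₚ.+-assoc s H D)) ⟩
    s + H + D ∸ s            ≡⟨ cong (λ k → k + D ∸ s) (ℕₚ.m+[n∸m]≡n s≤h) ⟩
    h + D ∸ s                ≡⟨ cong (_∸ s) (ℕₚ.m+[n∸m]≡n h≤n) ⟩
    n ∸ s                    ∎

  c≤H+D : c ≤ H + D
  c≤H+D = subst (c ≤_) (sym H+D≡n∸s) (ℕₚ.m+n≤o⇒m≤o∸n c c+s≤n)
    where
    c+s≤n : c + s ≤ n
    c+s≤n = subst₂ _≤_ (ℕₚ.+-comm s c) (sym n≡1+m+[s+c]) (ℕₚ.m≤n+m (s + c) (suc m))

  summation-length : suc ((s + c) ⊓ h) ∸ s ≡ suc L
  summation-length = begin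
    suc ((s + c) ⊓ h) ∸ s          ≡⟨ cong (λ k → suc ((s + c) ⊓ k) ∸ s) (sym (ℕₚ.m+[n∸m]≡n s≤h)) ⟩
    suc ((s + c) ⊓ (s + H)) ∸ s    ≡⟨ cong (λ k → suc k ∸ s) (sym (ℕₚ.+-distribˡ-⊓ s c H)) ⟩
    suc (s + L) ∸ s                ≡⟨ cong (_∸ s) (sym (ℕₚ.+-suc s L)) ⟩
    s + suc L ∸ s                  ≡⟨ ℕₚ.m+n∸m≡n s (suc L) ⟩
    suc L                          ∎

  LHS≡∑< : LHS q n h a b c s ≡ ∑< (suc L) (λ j → M q n h a b c (s + j) s)
  LHS≡∑< = trans (sumFromTo≡∑< s ((s + c) ⊓ h) (λ i → M q n h a b c i s))
                 (cong (λ k → ∑< k (λ j → M q n h a b c (s + j) s)) summation-length)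

  𝒞 K : ℚ
  𝒞 = Cc q (+ h ℤ.+ 1ℤ ℤ.- + s) a (b ∸ s) c
  K = negq q ^ᶻ E₀ (+ n) (+ h) (+ s) (+ c) * sgn (+ s ℤ.+ + h) * inv (qfac D * qfac h) * Pfrom q s h
      * (qfac c * qfac b) * inv (qfac (b ∸ s)) * 𝒞

  module _ {j : ℕ} (j≤L : j ≤ L) where

    j≤c : j ≤ c
    j≤c = ℕₚ.≤-trans j≤L (ℕₚ.m⊓n≤m c H)

    j≤H : j ≤ H
    j≤H = ℕₚ.≤-trans j≤L (ℕₚ.m⊓n≤n c H)

    s+j≤h : s + j ≤ h
    s+j≤h = subst (s + j ≤_) (ℕₚ.m+[n∸m]≡n s≤h) (ℕₚ.+-monoʳ-≤ s j≤H)

    M-power : pw q (M-exponent (+ n) (+ h) (+ (s + j)) (+ s) (+ c)) ≡ negq q ^ᶻ E₀ (+ n) (+ h) (+ s) (+ c) * t^ + choose₂ j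
    M-power = trans (pw≡negq^ᶻ q (M-exponent (+ n) (+ h) (+ (s + j)) (+ s) (+ c)))
      (trans (cong (negq q ^ᶻ_) (M-exponent-at (+ n) (+ h) (+ s) (+ c) (+ j) (+ choose₂ j) (j*j-j≡2*choose₂ j)))
             (^ᶻ-+ negq≢0 (E₀ (+ n) (+ h) (+ s) (+ c)) (ℤ.- + choose₂ j)))

    M-sign : sgn (+ (s + j) ℤ.+ + h) ≡ sgn (+ s ℤ.+ + h) * sgn (+ j)
    M-sign = trans (cong sgn (swap (+ s) (+ j) (+ h))) (sgn-+ (+ s ℤ.+ + h) (+ j))
      where
      swap : ∀ S J H → S ℤ.+ J ℤ.+ H ≡ S ℤ.+ H ℤ.+ J
      swap = solve-∀

    M-ratio₁ : P q (+ n ℤ.- + (s + j)) /ₜ (P q (+ n ℤ.- + h) * P q (+ h)) ≡ qfac (n ∸ s ∸ j) * inv (qfac D * qfac h)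
    M-ratio₁ = trans (/ₜ≡*inv numerator denominator) (cong₂ (λ u v → u * inv v)
      (P-diff (ℕₚ.≤-trans s+j≤h h≤n) (sym (ℕₚ.∸-+-assoc n s j)))
      (cong₂ _*_ (P-diff h≤n refl) (P≡qfac h)))
      where
      numerator denominator : ℚ
      numerator   = P q (+ n ℤ.- + (s + j))
      denominator = P q (+ n ℤ.- + h) * P q (+ h)

    M-ratio₂ : Pfrom q s h /ₜ (P q (+ h ℤ.- + (s + j)) * P q (+ (s + j) ℤ.- + s))
               ≡ Pfrom q s h * (inv (qfac (H ∸ j)) * inv (qfac j))
    M-ratio₂ = trans (/ₜ≡*inv (Pfrom q s h) denominator) (cong (Pfrom q s h *_) (trans
      (cong inv (cong₂ _*_ (P-diff s+j≤h (sym (ℕₚ.∸-+-assoc h s j))) (P-diff (ℕₚ.m≤m+n s j) (ℕₚ.m+n∸m≡n s j))))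
      (inv-distrib-* (qfac-≢0 (H ∸ j)) (qfac-≢0 j))))
      where
      denominator : ℚ
      denominator = P q (+ h ℤ.- + (s + j)) * P q (+ (s + j) ℤ.- + s)

    M-ratio₃ : (P q (+ c) * P q (+ b)) /ₜ (P q (+ c ℤ.- + (s + j) ℤ.+ + s) * P q (+ b ℤ.- + s))
               ≡ (qfac c * qfac b) * (inv (qfac (c ∸ j)) * inv (qfac (b ∸ s)))
    M-ratio₃ = trans (/ₜ≡*inv (P q (+ c) * P q (+ b)) denominator) (cong₂ _*_
      (cong₂ _*_ (P≡qfac c) (P≡qfac b))
      (trans (cong inv (cong₂ _*_ (trans (cong (P q) (cancel (+ c) (+ s) (+ j))) (P-diff j≤c refl)) (P-diff s≤b refl)))
             (inv-distrib-* (qfac-≢0 (c ∸ j)) (qfac-≢0 (b ∸ s)))))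
      where
      denominator : ℚ
      denominator = P q (+ c ℤ.- + (s + j) ℤ.+ + s) * P q (+ b ℤ.- + s)
      cancel : ∀ C S J → C ℤ.- (S ℤ.+ J) ℤ.+ S ≡ C ℤ.- J
      cancel = solve-∀

    𝒞-at : Cc q (+ h ℤ.+ 1ℤ ℤ.- + s) a (b ∸ s) ((c + s) ∸ (s + j)) ≡ 𝒞
    𝒞-at = trans (Cc-product _ a (b ∸ s) _ a+[b∸s]≡1+m) (sym (Cc-product _ a (b ∸ s) c a+[b∸s]≡1+m))

    term : ℚ
    term = sgn (+ j) * t^ + choose₂ j * (qfac (n ∸ s ∸ j) * inv (qfac (H ∸ j)) * inv (qfac j) * inv (qfac (c ∸ j)))

    M≡K*term : M q n h a b c (s + j) s ≡ K * term
    M≡K*term = trans (cong₂ _*_ (cong₂ _*_ (cong₂ _*_ (cong₂ _*_ (cong₂ _*_ M-power M-sign) M-ratio₁) M-ratio₂) M-ratio₃) 𝒞-at)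
      (×-Solver.solve 14 (λ pE tC sSH sJ PN iDh Pf iH iJ Pc Pb iC iB C →
         (pE ⊗ tC) ⊗ (sSH ⊗ sJ) ⊗ (PN ⊗ iDh) ⊗ (Pf ⊗ (iH ⊗ iJ)) ⊗ ((Pc ⊗ Pb) ⊗ (iC ⊗ iB)) ⊗ C
         ⊜ (pE ⊗ sSH ⊗ iDh ⊗ Pf ⊗ (Pc ⊗ Pb) ⊗ iB ⊗ C) ⊗ (sJ ⊗ tC ⊗ (PN ⊗ iH ⊗ iJ ⊗ iC))) refl
         (negq q ^ᶻ E₀ (+ n) (+ h) (+ s) (+ c)) (t^ + choose₂ j) (sgn (+ s ℤ.+ + h)) (sgn (+ j)) (qfac (n ∸ s ∸ j))
         (inv (qfac D * qfac h)) (Pfrom q s h) (inv (qfac (H ∸ j))) (inv (qfac j)) (qfac c) (qfac b)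
         (inv (qfac (c ∸ j))) (inv (qfac (b ∸ s))) 𝒞)

    qfac*term : qfac c * term ≡ qbinom c j * qdiffTerm D (+ H) j
    qfac*term = begin
      qfac c * (sJ * tC * (qfac (n ∸ s ∸ j) * iH * iJ * iC))
        ≡⟨ cong₂ (λ u v → u * (sJ * tC * (v * iH * iJ * iC))) (sym binomial) (sym pochhammer) ⟩
      qbinom c j * qfac j * qfac (c ∸ j) * (sJ * tC * (qfac (H ∸ j) * G * iH * iJ * iC))
        ≡⟨ ×-Solver.solve 10 (λ qb Pj Pc PH G sJ tC iH iJ iC →
             qb ⊗ Pj ⊗ Pc ⊗ (sJ ⊗ tC ⊗ (PH ⊗ G ⊗ iH ⊗ iJ ⊗ iC))
             ⊜ qb ⊗ (sJ ⊗ tC ⊗ G) ⊗ (Pj ⊗ iJ) ⊗ (Pc ⊗ iC) ⊗ (PH ⊗ iH)) refl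
             (qbinom c j) (qfac j) (qfac (c ∸ j)) (qfac (H ∸ j)) G sJ tC iH iJ iC ⟩
      qbinom c j * (sJ * tC * G) * (qfac j * iJ) * (qfac (c ∸ j) * iC) * (qfac (H ∸ j) * iH)
        ≡⟨ *-inv-cancel³ _ (qfac-≢0 j) (qfac-≢0 (c ∸ j)) (qfac-≢0 (H ∸ j)) ⟩
      qbinom c j * qdiffTerm D (+ H) j   ∎
      where
      sJ tC iH iJ iC G : ℚ
      sJ = sgn (+ j)
      tC = t^ + choose₂ j
      iH = inv (qfac (H ∸ j))
      iJ = inv (qfac j)
      iC = inv (qfac (c ∸ j))
      G  = qpoch D (+ H ℤ.- + j)
      binomial : qbinom c j * qfac j * qfac (c ∸ j) ≡ qfac c
      binomial = subst (λ k → qbinom k j * qfac j * qfac (c ∸ j) ≡ qfac k) (ℕₚ.m+[n∸m]≡n j≤c) (qbinom*qfac*qfac j (c ∸ j))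
      pochhammer : qfac (H ∸ j) * G ≡ qfac (n ∸ s ∸ j)
      pochhammer = begin
        qfac (H ∸ j) * G                    ≡⟨ cong (λ z → qfac (H ∸ j) * qpoch D z) (+m-+n≡+[m∸n] j≤H) ⟩
        qfac (H ∸ j) * qpoch D (+ (H ∸ j))  ≡⟨ qfac*qpoch (H ∸ j) D ⟩
        qfac (H ∸ j + D)                    ≡⟨ cong qfac (sym (ℕₚ.+-∸-comm D j≤H)) ⟩
        qfac (H + D ∸ j)                    ≡⟨ cong (λ k → qfac (k ∸ j)) H+D≡n∸s ⟩
        qfac (n ∸ s ∸ j)                    ∎

    qfac*M : qfac c * M q n h a b c (s + j) s ≡ K * (qbinom c j * qdiffTerm D (+ H) j)
    qfac*M = trans (cong (qfac c *_) M≡K*term) (trans (*-x∙yz≈y∙xz (qfac c) K term) (cong (K *_) qfac*term))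

  qdiffTerm-beyond : ∀ {j} → L < j → j ≤ c → qdiffTerm D (+ H) j ≡ 0ℚ
  qdiffTerm-beyond {j} L<j j≤c = begin
    sgn (+ j) * t^ + choose₂ j * qpoch D (+ H ℤ.- + j)        ≡⟨ cong (λ z → sgn (+ j) * t^ + choose₂ j * qpoch D z) H-j≡-[j∸H] ⟩
    sgn (+ j) * t^ + choose₂ j * qpoch D (ℤ.- + (j ∸ H))     ≡⟨ cong (sgn (+ j) * t^ + choose₂ j *_) (qpoch-≡0 D 1≤j∸H j∸H≤D) ⟩
    sgn (+ j) * t^ + choose₂ j * 0ℚ                          ≡⟨ ℚₚ.*-zeroʳ (sgn (+ j) * t^ + choose₂ j) ⟩
    0ℚ                                                       ∎
    where
    H<j : H < j
    H<j = ℕₚ.≰⇒> (λ j≤H → ℕₚ.<⇒≱ L<j (ℕₚ.⊓-glb j≤c j≤H))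
    H-j≡-[j∸H] : + H ℤ.- + j ≡ ℤ.- + (j ∸ H)
    H-j≡-[j∸H] = trans (ℤₚ.m-n≡m⊖n H j) (ℤₚ.⊖-≤ (ℕₚ.<⇒≤ H<j))
    1≤j∸H : 1 ≤ j ∸ H
    1≤j∸H = ℕₚ.m<n⇒0<n∸m H<j
    j∸H≤D : j ∸ H ≤ D
    j∸H≤D = ℕₚ.m≤n+o⇒m∸n≤o j H (ℕₚ.≤-trans j≤c c≤H+D)

  qfac*LHS : qfac c * LHS q n h a b c s ≡ K * qdiff D c (+ H)
  qfac*LHS = begin
    qfac c * LHS q n h a b c s
      ≡⟨ cong (qfac c *_) LHS≡∑< ⟩
    qfac c * ∑< (suc L) (λ j → M q n h a b c (s + j) s)
      ≡⟨ *-distribˡ-∑< (suc L) (qfac c) (λ j → M q n h a b c (s + j) s) ⟩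
    ∑< (suc L) (λ j → qfac c * M q n h a b c (s + j) s)
      ≡⟨ ∑<-cong (suc L) (λ j j<1+L → qfac*M (ℕₚ.≤-pred j<1+L)) ⟩
    ∑< (suc L) (λ j → K * f j)
      ≡⟨ sym (*-distribˡ-∑< (suc L) K f) ⟩
    K * ∑< (suc L) f
      ≡⟨ cong (K *_) (sym (∑<-+-zeros (suc L) (c ∸ L) f f≡0)) ⟩
    K * ∑< (suc L + (c ∸ L)) f
      ≡⟨ cong (λ k → K * ∑< k f) 1+L+[c∸L]≡1+c ⟩
    K * qdiff D c (+ H)   ∎
    where
    f : ℕ → ℚ
    f j = qbinom c j * qdiffTerm D (+ H) j
    1+L+[c∸L]≡1+c : suc L + (c ∸ L) ≡ suc c
    1+L+[c∸L]≡1+c = cong suc (ℕₚ.m+[n∸m]≡n (ℕₚ.m⊓n≤m c H))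
    f≡0 : ∀ j → suc L ≤ j → j < suc L + (c ∸ L) → f j ≡ 0ℚ
    f≡0 j L<j j<1+c = trans (cong (qbinom c j *_) (qdiffTerm-beyond L<j (ℕₚ.≤-pred (subst (j <_) 1+L+[c∸L]≡1+c j<1+c))))
                            (ℚₚ.*-zeroʳ (qbinom c j))

  LHS≡0 : D < c → LHS q n h a b c s ≡ 0ℚ
  LHS≡0 D<c = *-cancelˡ-≡ (qfac-≢0 c) (begin
    qfac c * LHS q n h a b c s     ≡⟨ qfac*LHS ⟩
    K * qdiff D c (+ H)            ≡⟨ cong (K *_) (qdiff-vanishes D c (+ H) D<c) ⟩
    K * 0ℚ                         ≡⟨ ℚₚ.*-zeroʳ K ⟩
    0ℚ                             ≡⟨ sym (ℚₚ.*-zeroʳ (qfac c)) ⟩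
    qfac c * 0ℚ                    ∎)

  module _ (c≤D : c ≤ D) where

    H+[D∸c]≡1+m : H + (D ∸ c) ≡ suc m
    H+[D∸c]≡1+m = begin
      H + (D ∸ c)                  ≡⟨ sym (ℕₚ.+-∸-assoc H c≤D) ⟩
      H + D ∸ c                    ≡⟨ cong (_∸ c) H+D≡n∸s ⟩
      n ∸ s ∸ c                    ≡⟨ ℕₚ.∸-+-assoc n s c ⟩
      n ∸ (s + c)                  ≡⟨ cong (_∸ (s + c)) n≡1+m+[s+c] ⟩
      suc m + (s + c) ∸ (s + c)    ≡⟨ ℕₚ.m+n∸n≡m (suc m) (s + c) ⟩
      suc m                        ∎

    n-c-s≡1+m : + n ℤ.- + c ℤ.- + s ≡ + suc m
    n-c-s≡1+m = trans (cong (λ k → + k ℤ.- + c ℤ.- + s) n≡1+m+[s+c]) (cancel (+ suc m) (+ s) (+ c))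
      where
      cancel : ∀ M S C → M ℤ.+ (S ℤ.+ C) ℤ.- C ℤ.- S ≡ M
      cancel = solve-∀

    n-c-s-1≡m : + n ℤ.- + c ℤ.- + s ℤ.- 1ℤ ≡ + m
    n-c-s-1≡m = trans (cong (ℤ._- 1ℤ) n-c-s≡1+m) (cancel (+ m))
      where
      cancel : ∀ M → 1ℤ ℤ.+ M ℤ.- 1ℤ ≡ M
      cancel = solve-∀

    X Den : ℚ
    X   = t^ (+ c ℤ.* + H) * qfac D * qfac (suc m)
    Den = qfac c * qfac (D ∸ c) * qfac H

    Den*LHS : Den * LHS q n h a b c s ≡ K * X
    Den*LHS = begin
      qfac c * qfac (D ∸ c) * qfac H * LHS q n h a b c s
        ≡⟨ ×-Solver.solve 4 (λ Pc Pd PH Y → Pc ⊗ Pd ⊗ PH ⊗ Y ⊜ Pc ⊗ Y ⊗ Pd ⊗ PH) refl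
             (qfac c) (qfac (D ∸ c)) (qfac H) (LHS q n h a b c s) ⟩
      qfac c * LHS q n h a b c s * qfac (D ∸ c) * qfac H
        ≡⟨ cong (λ u → u * qfac (D ∸ c) * qfac H) qfac*LHS ⟩
      K * qdiff D c (+ H) * qfac (D ∸ c) * qfac H
        ≡⟨ cong (_* qfac H) (ℚₚ.*-assoc K (qdiff D c (+ H)) (qfac (D ∸ c))) ⟩
      K * (qdiff D c (+ H) * qfac (D ∸ c)) * qfac H
        ≡⟨ cong (λ u → K * u * qfac H) (qdiff-closed D c (+ H) c≤D) ⟩
      K * (t^ (+ c ℤ.* + H) * qfac D * qpoch (D ∸ c) (+ H)) * qfac H
        ≡⟨ ×-Solver.solve 5 (λ K t PD G PH → K ⊗ (t ⊗ PD ⊗ G) ⊗ PH ⊜ K ⊗ (t ⊗ PD ⊗ (PH ⊗ G))) refl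
             K (t^ (+ c ℤ.* + H)) (qfac D) (qpoch (D ∸ c) (+ H)) (qfac H) ⟩
      K * (t^ (+ c ℤ.* + H) * qfac D * (qfac H * qpoch (D ∸ c) (+ H)))
        ≡⟨ cong (λ u → K * (t^ (+ c ℤ.* + H) * qfac D * u)) (trans (qfac*qpoch H (D ∸ c)) (cong qfac H+[D∸c]≡1+m)) ⟩
      K * X   ∎

    pE sSH sC sm pT iD ih is iB iC iDc iH ratio : ℚ
    pE  = negq q ^ᶻ E₀ (+ n) (+ h) (+ s) (+ c)
    sSH = sgn (+ s ℤ.+ + h)
    sC  = sgn (+ h ℤ.+ 1ℤ ℤ.- + s ℤ.+ 1ℤ)
    sm  = sgn (+ m)
    pT  = negq q ^ᶻ + choose₂ (suc m)
    iD  = inv (qfac D)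
    ih  = inv (qfac h)
    is  = inv (qfac s)
    iB  = inv (qfac (b ∸ s))
    iC  = inv (qfac c)
    iDc = inv (qfac (D ∸ c))
    iH  = inv (qfac H)
    ratio = qfac b * qfac (suc m) * qfac m * (iB * is * iDc * iH)

    K≡ : K ≡ pE * sSH * (iD * ih) * (qfac h * is) * (qfac c * qfac b) * iB * (sC * (sm * pT * qfac m))
    K≡ = trans (cong₂ (λ u v → pE * sSH * u * v * (qfac c * qfac b) * iB * 𝒞)
                      (inv-distrib-* (qfac-≢0 D) (qfac-≢0 h))
                      (*≡⇒≡*inv (qfac-≢0 s) (qfac*Pfrom s≤h)))
               (cong (pE * sSH * (iD * ih) * (qfac h * is) * (qfac c * qfac b) * iB *_)
                     (trans (Cc-product _ a (b ∸ s) c a+[b∸s]≡1+m) (cong (sC *_) (1-x^-product m))))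

    inv-Den : inv Den ≡ iC * iDc * iH
    inv-Den = trans (inv-distrib-* (*-≢0 (qfac-≢0 c) (qfac-≢0 (D ∸ c))) (qfac-≢0 H))
                    (cong (_* iH) (inv-distrib-* (qfac-≢0 c) (qfac-≢0 (D ∸ c))))

    sign : sSH * sC * sm ≡ sgn (+ n ℤ.+ + c ℤ.+ + s ℤ.+ 1ℤ)
    sign = trans (cong (λ z → sSH * sC * sgn z) (sym n-c-s-1≡m)) (sgn-collect (+ n) (+ h) (+ s) (+ c))

    power : pE * pT * t^ (+ c ℤ.* + H) ≡ negq q ^ᶻ RHS1-exponent (+ n) (+ h) (+ s) (+ c)
    power = begin
      pE * pT * t^ (+ c ℤ.* + H)
        ≡⟨ cong (pE * pT *_) (cong (λ z → negq q ^ᶻ (ℤ.- (+ c ℤ.* z))) (sym (+m-+n≡+[m∸n] s≤h))) ⟩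
      pE * pT * negq q ^ᶻ (ℤ.- (+ c ℤ.* (+ h ℤ.- + s)))
        ≡⟨ cong (_* negq q ^ᶻ (ℤ.- (+ c ℤ.* (+ h ℤ.- + s)))) (sym (^ᶻ-+ negq≢0 (E₀ (+ n) (+ h) (+ s) (+ c)) (+ choose₂ (suc m)))) ⟩
      negq q ^ᶻ (E₀ (+ n) (+ h) (+ s) (+ c) ℤ.+ + choose₂ (suc m)) * negq q ^ᶻ (ℤ.- (+ c ℤ.* (+ h ℤ.- + s)))
        ≡⟨ sym (^ᶻ-+ negq≢0 (E₀ (+ n) (+ h) (+ s) (+ c) ℤ.+ + choose₂ (suc m)) (ℤ.- (+ c ℤ.* (+ h ℤ.- + s)))) ⟩
      negq q ^ᶻ (E₀ (+ n) (+ h) (+ s) (+ c) ℤ.+ + choose₂ (suc m) ℤ.- + c ℤ.* (+ h ℤ.- + s))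
        ≡⟨ cong (negq q ^ᶻ_) (sym (RHS1-exponent≡ (+ n) (+ h) (+ s) (+ c) (+ choose₂ (suc m)) M²-M≡2T)) ⟩
      negq q ^ᶻ RHS1-exponent (+ n) (+ h) (+ s) (+ c)   ∎
      where
      M²-M≡2T : (+ n ℤ.- + c ℤ.- + s) ℤ.* (+ n ℤ.- + c ℤ.- + s) ℤ.- (+ n ℤ.- + c ℤ.- + s) ≡ + 2 ℤ.* + choose₂ (suc m)
      M²-M≡2T = subst (λ z → z ℤ.* z ℤ.- z ≡ + 2 ℤ.* + choose₂ (suc m)) (sym n-c-s≡1+m) (j*j-j≡2*choose₂ (suc m))

    RHS1≡ : RHS1 q n h b c s ≡ sgn (+ n ℤ.+ + c ℤ.+ + s ℤ.+ 1ℤ) * negq q ^ᶻ RHS1-exponent (+ n) (+ h) (+ s) (+ c) * ratio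
    RHS1≡ = cong₂ (λ u v → sgn (+ n ℤ.+ + c ℤ.+ + s ℤ.+ 1ℤ) * u * v)
      (pw≡negq^ᶻ q (RHS1-exponent (+ n) (+ h) (+ s) (+ c)))
      (trans (/ₜ≡*inv (P q (+ b) * P q (+ n ℤ.- + c ℤ.- + s) * P q (+ n ℤ.- + c ℤ.- + s ℤ.- 1ℤ))
                      (P q (+ b ℤ.- + s) * P q (+ s) * P q (+ n ℤ.- + h ℤ.- + c) * P q (+ h ℤ.- + s)))
             (cong₂ _*_ numerator (trans (cong inv denominator) inverse)))
      where
      numerator : P q (+ b) * P q (+ n ℤ.- + c ℤ.- + s) * P q (+ n ℤ.- + c ℤ.- + s ℤ.- 1ℤ) ≡ qfac b * qfac (suc m) * qfac m
      numerator = cong₂ _*_ (cong₂ _*_ (P≡qfac b) (trans (cong (P q) n-c-s≡1+m) (P≡qfac (suc m))))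
                            (trans (cong (P q) n-c-s-1≡m) (P≡qfac m))
      denominator : P q (+ b ℤ.- + s) * P q (+ s) * P q (+ n ℤ.- + h ℤ.- + c) * P q (+ h ℤ.- + s)
                    ≡ qfac (b ∸ s) * qfac s * qfac (D ∸ c) * qfac H
      denominator = cong₂ _*_ (cong₂ _*_ (cong₂ _*_ (P-diff s≤b refl) (P≡qfac s))
                                         (trans (cong (λ z → P q (z ℤ.- + c)) (+m-+n≡+[m∸n] h≤n)) (P-diff c≤D refl)))
                              (P-diff s≤h refl)
      inverse : inv (qfac (b ∸ s) * qfac s * qfac (D ∸ c) * qfac H) ≡ iB * is * iDc * iH
      inverse = trans (inv-distrib-* (*-≢0 (*-≢0 (qfac-≢0 (b ∸ s)) (qfac-≢0 s)) (qfac-≢0 (D ∸ c))) (qfac-≢0 H))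
                (cong (_* iH) (trans (inv-distrib-* (*-≢0 (qfac-≢0 (b ∸ s)) (qfac-≢0 s)) (qfac-≢0 (D ∸ c)))
                (cong (_* iDc) (inv-distrib-* (qfac-≢0 (b ∸ s)) (qfac-≢0 s)))))

    LHS≡RHS1 : LHS q n h a b c s ≡ RHS1 q n h b c s
    LHS≡RHS1 = begin
      LHS q n h a b c s
        ≡⟨ *≡⇒≡*inv Den≢0 Den*LHS ⟩
      K * X * inv Den
        ≡⟨ cong₂ (λ u v → u * X * v) K≡ inv-Den ⟩
      pE * sSH * (iD * ih) * (qfac h * is) * (qfac c * qfac b) * iB * (sC * (sm * pT * qfac m))
        * (t^ (+ c ℤ.* + H) * qfac D * qfac (suc m)) * (iC * iDc * iH)
        ≡⟨ ×-Solver.solve 19 (λ pE sSH iD ih Ph is Pc Pb iB sC sm pT Pm tcH PD PM1 iC iDc iH →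
             pE ⊗ sSH ⊗ (iD ⊗ ih) ⊗ (Ph ⊗ is) ⊗ (Pc ⊗ Pb) ⊗ iB ⊗ (sC ⊗ (sm ⊗ pT ⊗ Pm)) ⊗ (tcH ⊗ PD ⊗ PM1) ⊗ (iC ⊗ iDc ⊗ iH)
             ⊜ sSH ⊗ sC ⊗ sm ⊗ (pE ⊗ pT ⊗ tcH) ⊗ (Pb ⊗ PM1 ⊗ Pm ⊗ (iB ⊗ is ⊗ iDc ⊗ iH)) ⊗ (PD ⊗ iD) ⊗ (Ph ⊗ ih) ⊗ (Pc ⊗ iC)) refl
             pE sSH iD ih (qfac h) is (qfac c) (qfac b) iB sC sm pT (qfac m) (t^ (+ c ℤ.* + H)) (qfac D) (qfac (suc m)) iC iDc iH ⟩
      sSH * sC * sm * (pE * pT * t^ (+ c ℤ.* + H)) * ratio * (qfac D * iD) * (qfac h * ih) * (qfac c * iC)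
        ≡⟨ *-inv-cancel³ _ (qfac-≢0 D) (qfac-≢0 h) (qfac-≢0 c) ⟩
      sSH * sC * sm * (pE * pT * t^ (+ c ℤ.* + H)) * ratio
        ≡⟨ cong₂ (λ u v → u * v * ratio) sign power ⟩
      sgn (+ n ℤ.+ + c ℤ.+ + s ℤ.+ 1ℤ) * negq q ^ᶻ RHS1-exponent (+ n) (+ h) (+ s) (+ c) * ratio
        ≡⟨ sym RHS1≡ ⟩
      RHS1 q n h b c s   ∎
      where
      Den≢0 : Den ≢ 0ℚ
      Den≢0 = *-≢0 (*-≢0 (qfac-≢0 c) (qfac-≢0 (D ∸ c))) (qfac-≢0 H)

oddPrimePower⇒2≤ : ∀ {q} → IsOddPrimePower q → 2 ≤ q
oddPrimePower⇒2≤ (p , zero  , _  , _ , k≢0 , _)    = ⊥-elim (k≢0 refl)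
oddPrimePower⇒2≤ (p , suc k , pr , _ , _   , q≡p^k) = subst (2 ≤_) (sym q≡p^k)
  (ℕₚ.≤-trans (ℕ.nonTrivial⇒n>1 p {{prime⇒nonTrivial pr}})
              (ℕₚ.m≤m*n p (p ℕ.^ k) {{ℕₚ.m^n≢0 p k {{ℕ.nonTrivial⇒nonZero p {{prime⇒nonTrivial pr}}}}}}))

excluded-case : ∀ {n a b c h s} → a + b + c ≡ n → s ≤ h → s ≤ b → h ≤ n → c ≤ n ∸ h →
                a + (b ∸ s) ≡ 0 → a ≡ 0 × b ≡ h × c ≡ n ∸ h
excluded-case {n} {a} {b} {c} {h} {s} a+b+c≡n s≤h s≤b h≤n c≤n∸h a+[b∸s]≡0 = a≡0 , b≡h , c≡n∸h
  where
  a≡0 : a ≡ 0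
  a≡0 = ℕₚ.m+n≡0⇒m≡0 a a+[b∸s]≡0
  b≡s : b ≡ s
  b≡s = ℕₚ.≤-antisym (ℕₚ.m∸n≡0⇒m≤n (ℕₚ.m+n≡0⇒n≡0 a a+[b∸s]≡0)) s≤b
  n≡b+c : n ≡ b + c
  n≡b+c = trans (sym a+b+c≡n) (cong (λ k → k + b + c) a≡0)
  h≤b : h ≤ b
  h≤b = ℕₚ.+-cancelʳ-≤ c h b (ℕₚ.≤-trans (ℕₚ.+-monoʳ-≤ h c≤n∸h) (ℕₚ.≤-reflexive (trans (ℕₚ.m+[n∸m]≡n h≤n) n≡b+c)))
  b≡h : b ≡ h
  b≡h = ℕₚ.≤-antisym (subst (_≤ h) (sym b≡s) s≤h) h≤b
  c≡n∸h : c ≡ n ∸ h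
  c≡n∸h = sym (trans (cong₂ _∸_ n≡b+c (sym b≡h)) (ℕₚ.m+n∸m≡n b c))

lemma9p1 : (q : ℕ) → IsOddPrimePower q →
           (n a b c h s : ℕ) → a ≤ n → b ≤ n → c ≤ n → h ≤ n → a + b + c ≡ n →
           s ≤ h ⊓ b →
           ((c ≤ n ∸ h → ¬ (a ≡ 0 × b ≡ h × c ≡ n ∸ h) →
             LHS q n h a b c s ≡ RHS1 q n h b c s)
           × (c > n ∸ h → a ≢ 0 → LHS q n h a b c s ≡ 0ℚ))
lemma9p1 q q-odd n a b c h s _ _ _ h≤n a+b+c≡n s≤h⊓b = part₁ , part₂
  where
  s≤h : s ≤ h
  s≤h = ℕₚ.≤-trans s≤h⊓b (ℕₚ.m⊓n≤m h b)
  s≤b : s ≤ b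
  s≤b = ℕₚ.≤-trans s≤h⊓b (ℕₚ.m⊓n≤n h b)
  2≤q : 2 ≤ q
  2≤q = oddPrimePower⇒2≤ q-odd
  part₁ : c ≤ n ∸ h → ¬ (a ≡ 0 × b ≡ h × c ≡ n ∸ h) → LHS q n h a b c s ≡ RHS1 q n h b c s
  part₁ c≤n∸h not-excluded = by-cases (a + (b ∸ s)) refl
    where
    by-cases : ∀ k → a + (b ∸ s) ≡ k → LHS q n h a b c s ≡ RHS1 q n h b c s
    by-cases zero    eq = ⊥-elim (not-excluded (excluded-case a+b+c≡n s≤h s≤b h≤n c≤n∸h eq))
    by-cases (suc m) eq = Lemma9p1Sum.LHS≡RHS1 2≤q a+b+c≡n s≤h s≤b h≤n eq c≤n∸h
  part₂ : c > n ∸ h → a ≢ 0 → LHS q n h a b c s ≡ 0ℚ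
  part₂ n∸h<c a≢0 = by-cases (a + (b ∸ s)) refl
    where
    by-cases : ∀ k → a + (b ∸ s) ≡ k → LHS q n h a b c s ≡ 0ℚ
    by-cases zero    eq = ⊥-elim (a≢0 (ℕₚ.m+n≡0⇒m≡0 a eq))
    by-cases (suc m) eq = Lemma9p1Sum.LHS≡0 2≤q a+b+c≡n s≤h s≤b h≤n eq n∸h<c
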